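{- Let $m=p_1p_2\cdots p_k$ with $p_1,\dots,p_k$ distinct primes. Then the vertices of the cyclotomic polytope $\mathcal{C}_m$ have all coordinates in $\{0,+1,-1\}$, and they are precisely the tensor products $v_1\otimes\cdots\otimes v_k$ with $v_i$ a vertex of $\mathcal{C}_{p_i}$. The only other lattice point in $\mathcal{C}_m$ is the origin, which lies in the interior of $\mathcal{C}_m$.
   Context: For $p$ prime, $\mathcal{C}_p=\operatorname{conv}(e_1,\dots,e_{p-1},-\sum_ie_i)\subset\mathbb{R}^{p-1}$. For squarefree $m=p_1\cdots p_k$, the cyclotomic polytope is $\mathcal{C}_m=\mathcal{C}_{p_1}\otimes\cdots\otimes\mathcal{C}_{p_k}\subset\mathbb{R}^{\phi(m)}=\mathbb{R}^{p_1-1}\otimes\cdots\otimes\mathbb{R}^{p_k-1}$ (Kronecker product coordinates), where for polytopes $P,Q$ with vertex sets $\{v_i\}$, $\{w_j\}$ the tensor product is $P\otimes Q=\operatorname{conv}(v_i\otimes w_j)$. (This corresponds to representing the $m$-th roots of unity in the $\mathbb{Z}$-basis of $\mathbb{Z}[\zeta_m]$ formed by products of the bases $1,\zeta_{p_i},\dots,\zeta_{p_i}^{p_i-2}$.)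
   Formalization: Points of $\mathbb{R}^{\phi(m)}$ and $\mathbb{R}^{p-1}$, including those of the box around the origin, have rational coordinates, and convex combinations have rational coefficients. -}

module Defs where

open import Data.Nat as ℕ using (ℕ; zero; suc; _∸_)
open import Data.Fin using (Fin; zero; suc; toℕ)
open import Data.Integer as ℤ using (ℤ)
open import Data.Rational as ℚ using (ℚ; 0ℚ; 1ℚ; _+_; _*_; -_; _≤_; _<_; ∣_∣)
open import Data.Vec as V using (Vec; []; _∷_; lookup; tabulate; replicate; zipWith; concat)
open import Data.List as L using (List)
open import Data.List.Relation.Unary.All using (All)
open import Data.Product using (Σ; ∃; _×_; _,_; proj₁; proj₂)
open import Data.Sum using (_⊎_)
open import Relation.Binary.PropositionalEquality using (_≡_; refl)
open import Relation.Nullary using (yes; no)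

dim : ∀ {k} → Vec ℕ k → ℕ
dim []       = 1
dim (p ∷ ps) = (p ∸ 1) ℕ.* dim ps

-- Kronecker product of vectors: (v ⊗ w)_{(a,b)} = v_a * w_b, first factor outermost
kron : ∀ {a b} → Vec ℚ a → Vec ℚ b → Vec ℚ (a ℕ.* b)
kron v w = concat (V.map (λ x → V.map (x *_) w) v)

tensor : ∀ {k} (ps : Vec ℕ k) → ((i : Fin k) → Vec ℚ (lookup ps i ∸ 1)) → Vec ℚ (dim ps)
tensor []       vs = 1ℚ ∷ []
tensor (p ∷ ps) vs = kron (vs zero) (tensor ps (λ i → vs (suc i)))

-- vertex list of C_p: e₁,…,e_{p-1}, -∑ eᵢ   (index j < p-1 ↦ e_j, index p-1 ↦ -∑eᵢ)
simplexGen : (p : ℕ) → Fin p → Vec ℚ (p ∸ 1)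
simplexGen p j = tabulate entry
  where
  entry : Fin (p ∸ 1) → ℚ
  entry r with toℕ j ℕ.≟ (p ∸ 1)
  ... | yes _ = - 1ℚ
  ... | no  _ with toℕ r ℕ.≟ toℕ j
  ...   | yes _ = 1ℚ
  ...   | no  _ = 0ℚ

-- convex hull of a family of generators g : I → ℚ^d (rational points; finite convex combinations)
combo : ∀ {d} {I : Set} → (I → Vec ℚ d) → List (ℚ × I) → Vec ℚ d
combo g L.[]            = replicate _ 0ℚ
combo g ((t , i) L.∷ L) = zipWith _+_ (V.map (t *_) (g i)) (combo g L)

weight : ∀ {I : Set} → List (ℚ × I) → ℚ
weight L = L.foldr (λ p acc → proj₁ p + acc) 0ℚ L

InConv : ∀ {d} {I : Set} → (I → Vec ℚ d) → Vec ℚ d → Set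
InConv {I = I} g x = Σ (List (ℚ × I)) λ L →
  All (λ p → 0ℚ ≤ proj₁ p) L × weight L ≡ 1ℚ × combo g L ≡ x

IsVertex : ∀ {d} {I : Set} → (I → Vec ℚ d) → Vec ℚ d → Set
IsVertex {d} g x = InConv g x ×
  (∀ (t : ℚ) (y z : Vec ℚ d) → 0ℚ < t → t < 1ℚ → InConv g y → InConv g z →
     x ≡ zipWith _+_ (V.map (t *_) y) (V.map ((1ℚ ℚ.- t) *_) z) → y ≡ z)

IsInterior : ∀ {d} {I : Set} → (I → Vec ℚ d) → Vec ℚ d → Set
IsInterior {d} g x = Σ ℚ λ ε → 0ℚ < ε ×
  (∀ (y : Vec ℚ d) → (∀ j → ∣ lookup y j ℚ.- lookup x j ∣ ≤ ε) → InConv g y)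

cycloGen : ∀ {k} (ps : Vec ℕ k) → ((i : Fin k) → Fin (lookup ps i)) → Vec ℚ (dim ps)
cycloGen ps c = tensor ps (λ i → simplexGen (lookup ps i) (c i))

IsLatticePoint : ∀ {d} → Vec ℚ d → Set
IsLatticePoint x = ∀ j → ℚ.denominator (lookup x j) ≡ ℤ.+ 1

-- A nonzero point of C_m all of whose coordinates lie in {0, ±1} can only be written as a
-- convex combination of generators equal to it. Pick a coordinate a with xₐ = ±1: since every
-- generator coordinate lies in {0, ±1}, each generator used takes the value xₐ there. Moving one
-- index of a elsewhere gives the coordinate xₐ · U, where U is the proportion of generators whose
-- i-th factor is the vertex -∑eⱼ; so U is 0 or 1, and that factor agrees for all generators used.
-- With the value at a this pins down the generator, the value settling the one factor that may
-- have pᵢ = 2 (this is where the primes must be distinct). Generators are such points, hence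
-- vertices, and so is every nonzero lattice point of C_m, whose coordinates are integers in
-- [-1, 1]; conversely every vertex is a generator. The origin is interior: for y near 0 each
-- column of y, rescaled, lies in a box around 0 inside C_{p₁}, and y is the average of these
-- columns tensored with the standard basis vectors, which are generators of C_{p₂⋯p_k}.

{-# OPTIONS --safe #-}
module Submission where

open import Defs
open import Level using (0ℓ)
open import Algebra.Bundles using (CommutativeRing)
open import Data.Bool using (if_then_else_)
open import Data.Nat as ℕ using (ℕ; zero; suc; _∸_; s≤s; z≤n)
import Data.Nat.Properties as ℕ
open import Data.Nat.Primality using (Prime; prime⇒nonTrivial)
open import Data.Fin as Fin using (Fin; zero; suc; toℕ; fromℕ; inject₁)
open import Data.Fin.Properties
  using (toℕ-fromℕ; toℕ-inject₁; toℕ-inject₁-≢; toℕ-injective; suc-injective; combine-remQuot; combine-injective)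
open import Data.Fin.Relation.Unary.Top using (view; ‵fromℕ; ‵inject₁)
import Data.Integer as ℤ
open import Data.Rational as ℚ using (ℚ; mkℚ; 0ℚ; 1ℚ; ½; _+_; _*_; -_; _-_; _≤_; _<_; ∣_∣; 1/_)
open import Data.Rational.Properties
open import Algebra.Properties.Group +-0-group using (x∙y⁻¹≈ε⇒x≈y; ⁻¹-involutive)
open import Algebra.Properties.Semiring.Sum (CommutativeRing.semiring +-*-commutativeRing)
  using (sum; sum-cong-≗; ∑-distrib-+; sum-replicate; sum-replicate-zero)
open import Algebra.Properties.Semiring.Mult (CommutativeRing.semiring +-*-commutativeRing)
  using (×-assoc-*) renaming (_×_ to _·_)
open import Data.Vec as Vec using (Vec; []; _∷_; lookup; replicate; zipWith)
open import Data.Vec.Properties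
  using (lookup-zipWith; lookup-map; lookup-replicate; lookup-concat; lookup∘tabulate; tabulate∘lookup; tabulate-cong)
open import Data.List as List using (List; []; _∷_; _++_)
open import Data.List.Relation.Unary.All as All using (All; []; _∷_)
import Data.List.Relation.Unary.All.Properties as All
open import Data.Product using (Σ; _×_; _,_; proj₁; proj₂)
open import Data.Sum using (_⊎_; inj₁; inj₂)
import Data.Sum as Sum
open import Function using (_∘_)
open import Function.Bundles using (_⇔_; mk⇔)
open import Relation.Nullary using (Dec; yes; no; does; ¬_; contradiction)
open import Relation.Nullary.Decidable using (dec⇒maybe; dec-true; dec-false)
open import Relation.Binary.Definitions using (tri<; tri≈; tri>)
open import Relation.Binary.PropositionalEquality
open import Tactic.RingSolver using (solve-∀)
open import Tactic.RingSolver.Core.AlmostCommutativeRing using (AlmostCommutativeRing; fromCommutativeRing)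

-- Rational arithmetic

-- The zero test lets the ring solver cancel numeric coefficients.
ℚ-ring : AlmostCommutativeRing 0ℓ 0ℓ
ℚ-ring = fromCommutativeRing +-*-commutativeRing (λ q → dec⇒maybe (0ℚ ≟ q))

0≤1 : 0ℚ ≤ 1ℚ
0≤1 = ≤ᵇ⇒≤ _

-1≤0 : - 1ℚ ≤ 0ℚ
-1≤0 = ≤ᵇ⇒≤ _

-1≤1 : - 1ℚ ≤ 1ℚ
-1≤1 = ≤ᵇ⇒≤ _

+-nonNeg : ∀ {p q} → 0ℚ ≤ p → 0ℚ ≤ q → 0ℚ ≤ p + q
+-nonNeg = +-mono-≤

*-nonNeg : ∀ {p q} → 0ℚ ≤ p → 0ℚ ≤ q → 0ℚ ≤ p * q
*-nonNeg {p} {q} 0≤p 0≤q =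
  nonNegative⁻¹ (p * q) {{nonNeg*nonNeg⇒nonNeg p {{ℚ.nonNegative 0≤p}} q {{ℚ.nonNegative 0≤q}}}}

p≤q⇒0≤q-p : ∀ {p q} → p ≤ q → 0ℚ ≤ q - p
p≤q⇒0≤q-p {p} {q} p≤q = subst (_≤ q - p) (+-inverseʳ p) (+-monoˡ-≤ (- p) p≤q)

0≤q-p⇒p≤q : ∀ {p q} → 0ℚ ≤ q - p → p ≤ q
0≤q-p⇒p≤q {p} {q} 0≤q-p = subst₂ _≤_ (+-identityˡ p) (q-p+p≡q p q) (+-monoˡ-≤ p 0≤q-p)
  where
  q-p+p≡q : ∀ p q → q - p + p ≡ q
  q-p+p≡q = solve-∀ ℚ-ring

p<q⇒0<q-p : ∀ {p q} → p < q → 0ℚ < q - p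
p<q⇒0<q-p {p} {q} p<q = subst (_< q - p) (+-inverseʳ p) (+-monoˡ-< (- p) p<q)

≤∧≢⇒< : ∀ {p q} → p ≤ q → p ≢ q → p < q
≤∧≢⇒< {p} {q} p≤q p≢q with <-cmp p q
... | tri< p<q _ _ = p<q
... | tri≈ _ p≡q _ = contradiction p≡q p≢q
... | tri> _ _ q<p = contradiction (≤-antisym p≤q (<⇒≤ q<p)) p≢q

p+q≡r⇒q≡r-p : ∀ {p q r} → p + q ≡ r → q ≡ r - p
p+q≡r⇒q≡r-p {p} {q} refl = q≡p+q-p p q
  where
  q≡p+q-p : ∀ p q → q ≡ p + q - p
  q≡p+q-p = solve-∀ ℚ-ring

1/pos>0 : ∀ p .{{_ : ℚ.Positive p}} → 0ℚ < (1/ p) {{pos⇒nonZero p}}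
1/pos>0 p = positive⁻¹ _ {{1/pos⇒pos p}}

p-q≡0⇒p≡q : ∀ {p q} → p - q ≡ 0ℚ → p ≡ q
p-q≡0⇒p≡q {p} {q} = x∙y⁻¹≈ε⇒x≈y p q

nonNeg+nonNeg≡0⇒≡0ˡ : ∀ {p q} → 0ℚ ≤ p → 0ℚ ≤ q → p + q ≡ 0ℚ → p ≡ 0ℚ
nonNeg+nonNeg≡0⇒≡0ˡ {p} {q} 0≤p 0≤q p+q≡0 = ≤-antisym p≤0 0≤p
  where
  p≤0 : p ≤ 0ℚ
  p≤0 = subst₂ _≤_ (+-identityʳ p) p+q≡0 (+-monoʳ-≤ p 0≤q)

nonNeg+nonNeg≡0⇒≡0ʳ : ∀ {p q} → 0ℚ ≤ p → 0ℚ ≤ q → p + q ≡ 0ℚ → q ≡ 0ℚ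
nonNeg+nonNeg≡0⇒≡0ʳ {p} {q} 0≤p 0≤q p+q≡0 = nonNeg+nonNeg≡0⇒≡0ˡ 0≤q 0≤p (trans (+-comm q p) p+q≡0)

*-cancelʳ-≢0 : ∀ {p q r} → r ≢ 0ℚ → p * r ≡ q * r → p ≡ q
*-cancelʳ-≢0 {p} {q} {r} r≢0 pr≡qr = begin
  p             ≡⟨ unscale p ⟨
  p * r * 1/r   ≡⟨ cong (_* 1/r) pr≡qr ⟩
  q * r * 1/r   ≡⟨ unscale q ⟩
  q             ∎
  where
  open ≡-Reasoning
  instance
    r-nonZero : ℚ.NonZero r
    r-nonZero = ℚ.≢-nonZero r≢0
  1/r : ℚ
  1/r = 1/ r
  unscale : ∀ x → x * r * 1/r ≡ x
  unscale x = trans (*-assoc x r 1/r) (trans (cong (x *_) (*-inverseʳ r)) (*-identityʳ x))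

p*q≡0⇒p≡0⊎q≡0 : ∀ {p q} → p * q ≡ 0ℚ → p ≡ 0ℚ ⊎ q ≡ 0ℚ
p*q≡0⇒p≡0⊎q≡0 {p} {q} pq≡0 with p ≟ 0ℚ
... | yes p≡0 = inj₁ p≡0
... | no  p≢0 = inj₂ (*-cancelʳ-≢0 p≢0 (trans (*-comm q p) (trans pq≡0 (sym (*-zeroˡ p)))))

Sign : ℚ → Set
Sign q = q ≡ 1ℚ ⊎ q ≡ - 1ℚ

Trit : ℚ → Set
Trit q = q ≡ 0ℚ ⊎ Sign q

sign-* : ∀ {p q} → Sign p → Sign q → Sign (p * q)
sign-* (inj₁ refl) (inj₁ refl) = inj₁ refl
sign-* (inj₁ refl) (inj₂ refl) = inj₂ refl
sign-* (inj₂ refl) (inj₁ refl) = inj₂ refl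
sign-* (inj₂ refl) (inj₂ refl) = inj₁ refl

sign-square : ∀ {s} → Sign s → s * s ≡ 1ℚ
sign-square (inj₁ refl) = refl
sign-square (inj₂ refl) = refl

sign⇒≢0 : ∀ {s} → Sign s → s ≢ 0ℚ
sign⇒≢0 (inj₁ refl) ()
sign⇒≢0 (inj₂ refl) ()

sign-*-involutive : ∀ {s} → Sign s → ∀ p → s * (s * p) ≡ p
sign-*-involutive {s} sign-s p = begin
  s * (s * p)  ≡⟨ *-assoc s s p ⟨
  s * s * p    ≡⟨ cong (_* p) (sign-square sign-s) ⟩
  1ℚ * p       ≡⟨ *-identityˡ p ⟩
  p            ∎
  where open ≡-Reasoning

sign-*-cancelˡ : ∀ {s p q} → Sign s → s * p ≡ s * q → p ≡ q
sign-*-cancelˡ {s} {p} {q} sign-s sp≡sq = begin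
  p            ≡⟨ sign-*-involutive sign-s p ⟨
  s * (s * p)  ≡⟨ cong (s *_) sp≡sq ⟩
  s * (s * q)  ≡⟨ sign-*-involutive sign-s q ⟩
  q            ∎
  where open ≡-Reasoning

trit-* : ∀ {p q} → Trit p → Trit q → Trit (p * q)
trit-* {q = q} (inj₁ refl) _ = inj₁ (*-zeroˡ q)
trit-* {p} (inj₂ sign-p) (inj₁ refl) = inj₁ (*-zeroʳ p)
trit-* (inj₂ sign-p) (inj₂ sign-q) = inj₂ (sign-* sign-p sign-q)

trit∧≢0⇒sign : ∀ {p} → Trit p → p ≢ 0ℚ → Sign p
trit∧≢0⇒sign (inj₁ p≡0)   p≢0 = contradiction p≡0 p≢0
trit∧≢0⇒sign (inj₂ sign-p) _  = sign-p

trit⇒≤1 : ∀ {p} → Trit p → p ≤ 1ℚ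
trit⇒≤1 (inj₁ refl)        = 0≤1
trit⇒≤1 (inj₂ (inj₁ refl)) = ≤-refl
trit⇒≤1 (inj₂ (inj₂ refl)) = -1≤1

trit⇒-1≤ : ∀ {p} → Trit p → - 1ℚ ≤ p
trit⇒-1≤ (inj₁ refl)        = -1≤0
trit⇒-1≤ (inj₂ (inj₁ refl)) = -1≤1
trit⇒-1≤ (inj₂ (inj₂ refl)) = ≤-refl

integer-trit : ∀ {q} → ℚ.denominator q ≡ ℤ.+ 1 → - 1ℚ ≤ q → q ≤ 1ℚ → Trit q
integer-trit {mkℚ (ℤ.+ zero)          zero _} refl _ _ = inj₁ refl
integer-trit {mkℚ (ℤ.+ suc zero)      zero _} refl _ _ = inj₂ (inj₁ refl)
integer-trit {mkℚ (ℤ.+ suc (suc n))   zero _} refl _ (ℚ.*≤* (ℤ.+≤+ (ℕ.s≤s ())))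
integer-trit {mkℚ ℤ.-[1+ zero ]       zero _} refl _ _ = inj₂ (inj₂ refl)
integer-trit {mkℚ ℤ.-[1+ suc n ]      zero _} refl (ℚ.*≤* (ℤ.-≤- ())) _

∣p∣≤q⇒-q≤p≤q : ∀ {p q} → ∣ p ∣ ≤ q → - q ≤ p × p ≤ q
∣p∣≤q⇒-q≤p≤q {p} {q} ∣p∣≤q = -q≤p , ≤-trans (p≤∣p∣ p) ∣p∣≤q
  where
  p≤∣p∣ : ∀ p → p ≤ ∣ p ∣
  p≤∣p∣ (mkℚ (ℤ.+ n)    _ _) = ≤-refl
  p≤∣p∣ (mkℚ ℤ.-[1+ n ] _ _) = ℚ.*≤* ℤ.-≤+
  -q≤p : - q ≤ p
  -q≤p = subst (- q ≤_) (⁻¹-involutive p)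
           (neg-antimono-≤ (≤-trans (subst (- p ≤_) (∣-p∣≡∣p∣ p) (p≤∣p∣ (- p))) ∣p∣≤q))

·-nonNeg : ∀ n → 0ℚ ≤ n · 1ℚ
·-nonNeg zero    = ≤-refl
·-nonNeg (suc n) = +-nonNeg 0≤1 (·-nonNeg n)

·-positive : ∀ n .{{_ : ℕ.NonZero n}} → 0ℚ < n · 1ℚ
·-positive (suc n) = +-mono-<-≤ (positive⁻¹ 1ℚ) (·-nonNeg n)

n·x≡[n·1]*x : ∀ n x → n · x ≡ (n · 1ℚ) * x
n·x≡[n·1]*x n x = sym (trans (×-assoc-* n 1ℚ x) (cong (n ·_) (*-identityˡ x)))

·-nonZero : ∀ n .{{_ : ℕ.NonZero n}} → ℚ.NonZero (n · 1ℚ)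
·-nonZero n = pos⇒nonZero (n · 1ℚ) {{ℚ.positive (·-positive n)}}

1/ℕ : ∀ n .{{_ : ℕ.NonZero n}} → ℚ
1/ℕ n = (1/ (n · 1ℚ)) {{·-nonZero n}}

1/ℕ-positive : ∀ n .{{_ : ℕ.NonZero n}} → 0ℚ < 1/ℕ n
1/ℕ-positive n = 1/pos>0 (n · 1ℚ) {{ℚ.positive (·-positive n)}}

1/ℕ-inverse : ∀ n .{{_ : ℕ.NonZero n}} → (n · 1ℚ) * 1/ℕ n ≡ 1ℚ
1/ℕ-inverse n = *-inverseʳ (n · 1ℚ) {{·-nonZero n}}

1/ℕ-cancel : ∀ n .{{_ : ℕ.NonZero n}} x → (n · 1ℚ) * (x * 1/ℕ n) ≡ x
1/ℕ-cancel n x = trans (swap (n · 1ℚ) x (1/ℕ n)) (trans (cong (x *_) (1/ℕ-inverse n)) (*-identityʳ x))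
  where
  swap : ∀ a b c → a * (b * c) ≡ b * (a * c)
  swap = solve-∀ ℚ-ring

δ : ∀ {n} → Fin n → Fin n → ℚ
δ s r = if does (s Fin.≟ r) then 1ℚ else 0ℚ

δ-diag : ∀ {n} (s : Fin n) → δ s s ≡ 1ℚ
δ-diag s rewrite dec-true (s Fin.≟ s) refl = refl

δ-off : ∀ {n} {s r : Fin n} → s ≢ r → δ s r ≡ 0ℚ
δ-off {s = s} {r} s≢r rewrite dec-false (s Fin.≟ r) s≢r = refl

sum-mono-≤ : ∀ {n} {f g : Fin n → ℚ} → (∀ i → f i ≤ g i) → sum f ≤ sum g
sum-mono-≤ {zero}  f≤g = ≤-refl
sum-mono-≤ {suc n} f≤g = +-mono-≤ (f≤g zero) (sum-mono-≤ (f≤g ∘ suc))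

sum-δ : ∀ {n} (f : Fin n → ℚ) t → sum (λ s → f s * δ s t) ≡ f t
sum-δ {suc n} f zero    = begin
  f zero * 1ℚ + sum (λ s → f (suc s) * 0ℚ)
    ≡⟨ cong₂ _+_ (*-identityʳ (f zero)) (trans (sum-cong-≗ (*-zeroʳ ∘ f ∘ suc)) (sum-replicate-zero n)) ⟩
  f zero + 0ℚ
    ≡⟨ +-identityʳ (f zero) ⟩
  f zero ∎
  where open ≡-Reasoning
sum-δ {suc n} f (suc t) = trans (cong (_+ sum (λ s → f (suc s) * δ s t)) (*-zeroʳ (f zero)))
                                (trans (+-identityˡ _) (sum-δ (f ∘ suc) t))

δ-combine : ∀ {m n} (r r′ : Fin m) (t t′ : Fin n) → δ (Fin.combine r t) (Fin.combine r′ t′) ≡ δ r r′ * δ t t′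
δ-combine r r′ t t′ = by-cases (r Fin.≟ r′) (t Fin.≟ t′)
  where
  by-cases : Dec (r ≡ r′) → Dec (t ≡ t′) → δ (Fin.combine r t) (Fin.combine r′ t′) ≡ δ r r′ * δ t t′
  by-cases (yes refl) (yes refl) = trans (δ-diag (Fin.combine r t)) (sym (cong₂ _*_ (δ-diag r) (δ-diag t)))
  by-cases (no r≢r′)  _          = trans (δ-off (r≢r′ ∘ proj₁ ∘ combine-injective r t r′ t′))
                                         (sym (trans (cong (_* δ t t′) (δ-off r≢r′)) (*-zeroˡ (δ t t′))))
  by-cases (yes _)    (no t≢t′)  = trans (δ-off (t≢t′ ∘ proj₂ ∘ combine-injective r t r′ t′))
                                         (sym (trans (cong (δ r r′ *_) (δ-off t≢t′)) (*-zeroʳ (δ r r′))))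

-- Weighted sums over lists

module _ {I : Set} where

  NonNeg : List (ℚ × I) → Set
  NonNeg = All (λ w → 0ℚ ≤ proj₁ w)

  OnSupport : (I → Set) → List (ℚ × I) → Set
  OnSupport P = All (λ w → proj₁ w ≡ 0ℚ ⊎ P (proj₂ w))

  wsum : List (ℚ × I) → (I → ℚ) → ℚ
  wsum []            f = 0ℚ
  wsum ((t , i) ∷ L) f = t * f i + wsum L f

  everywhere : ∀ {P : I → Set} → (∀ i → P i) → ∀ L → OnSupport P L
  everywhere P-all = All.universal (λ w → inj₂ (P-all (proj₂ w)))

  onSupport-map : ∀ {P Q : I → Set} → (∀ {i} → P i → Q i) → ∀ {L} → OnSupport P L → OnSupport Q L
  onSupport-map P⇒Q = All.map (Sum.map₂ P⇒Q)

  onSupport-× : ∀ {P Q : I → Set} {L} → OnSupport P L → OnSupport Q L → OnSupport (λ i → P i × Q i) L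
  onSupport-× []                []                = []
  onSupport-× (inj₁ t≡0 ∷ onP) (_ ∷ onQ)         = inj₁ t≡0 ∷ onSupport-× onP onQ
  onSupport-× (inj₂ _ ∷ onP)   (inj₁ t≡0 ∷ onQ)  = inj₁ t≡0 ∷ onSupport-× onP onQ
  onSupport-× (inj₂ Pi ∷ onP)  (inj₂ Qi ∷ onQ)   = inj₂ (Pi , Qi) ∷ onSupport-× onP onQ

  onSupport-∀ : ∀ {A : Set} {P : A → I → Set} L →
                (∀ a → OnSupport (P a) L) → OnSupport (λ i → ∀ a → P a i) L
  onSupport-∀ []            _     = []
  onSupport-∀ ((t , i) ∷ L) onP with t ≟ 0ℚ
  ... | yes t≡0 = inj₁ t≡0 ∷ onSupport-∀ L (λ a → All.tail (onP a))
  ... | no  t≢0 = inj₂ (λ a → supported (All.head (onP a))) ∷ onSupport-∀ L (λ a → All.tail (onP a))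
    where
    supported : ∀ {Q : Set} → t ≡ 0ℚ ⊎ Q → Q
    supported (inj₁ t≡0) = contradiction t≡0 t≢0
    supported (inj₂ q)   = q

  support-witness : ∀ L → weight L ≢ 0ℚ → Σ I (λ i → ∀ {P : I → Set} → OnSupport P L → P i)
  support-witness []            weight≢0 = contradiction refl weight≢0
  support-witness ((t , i) ∷ L) weight≢0 with t ≟ 0ℚ
  ... | no t≢0  = i , λ { (inj₁ t≡0 ∷ _) → contradiction t≡0 t≢0 ; (inj₂ Pi ∷ _) → Pi }
  ... | yes refl with support-witness L (λ w≡0 → weight≢0 (trans (+-identityˡ (weight L)) w≡0))
  ...   | j , on-j = j , λ onP → on-j (All.tail onP)

  wsum-cong : ∀ L {f g : I → ℚ} → OnSupport (λ i → f i ≡ g i) L → wsum L f ≡ wsum L g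
  wsum-cong []            []                = refl
  wsum-cong ((t , i) ∷ L) {f} {g} (inj₁ refl ∷ on) =
    cong₂ _+_ (trans (*-zeroˡ (f i)) (sym (*-zeroˡ (g i)))) (wsum-cong L on)
  wsum-cong ((t , i) ∷ L) (inj₂ fi≡gi ∷ on) = cong₂ _+_ (cong (t *_) fi≡gi) (wsum-cong L on)

  wsum-scale : ∀ L c f → wsum L (λ i → c * f i) ≡ c * wsum L f
  wsum-scale []            c f = sym (*-zeroʳ c)
  wsum-scale ((t , i) ∷ L) c f =
    trans (cong (t * (c * f i) +_) (wsum-scale L c f)) (factor t c (f i) (wsum L f))
    where
    factor : ∀ t c x s → t * (c * x) + c * s ≡ c * (t * x + s)
    factor = solve-∀ ℚ-ring

  wsum-sub : ∀ L f g → wsum L (λ i → f i - g i) ≡ wsum L f - wsum L g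
  wsum-sub []            f g = refl
  wsum-sub ((t , i) ∷ L) f g =
    trans (cong (t * (f i - g i) +_) (wsum-sub L f g)) (regroup t (f i) (g i) (wsum L f) (wsum L g))
    where
    regroup : ∀ t x y a b → t * (x - y) + (a - b) ≡ (t * x + a) - (t * y + b)
    regroup = solve-∀ ℚ-ring

  wsum-const : ∀ L c → wsum L (λ _ → c) ≡ c * weight L
  wsum-const []            c = sym (*-zeroʳ c)
  wsum-const ((t , i) ∷ L) c =
    trans (cong (t * c +_) (wsum-const L c)) (trans (cong (_+ c * weight L) (*-comm t c)) (sym (*-distribˡ-+ c t (weight L))))

  wsum-nonNeg : ∀ L {f} → NonNeg L → (∀ i → 0ℚ ≤ f i) → 0ℚ ≤ wsum L f
  wsum-nonNeg []            []           _   = ≤-refl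
  wsum-nonNeg ((t , i) ∷ L) (0≤t ∷ 0≤L) 0≤f = +-nonNeg (*-nonNeg 0≤t (0≤f i)) (wsum-nonNeg L 0≤L 0≤f)

  wsum-nonNeg≡0 : ∀ L {f} → NonNeg L → (∀ i → 0ℚ ≤ f i) → wsum L f ≡ 0ℚ → OnSupport (λ i → f i ≡ 0ℚ) L
  wsum-nonNeg≡0 []            []           _   _      = []
  wsum-nonNeg≡0 ((t , i) ∷ L) {f} (0≤t ∷ 0≤L) 0≤f sum≡0 =
    p*q≡0⇒p≡0⊎q≡0 (nonNeg+nonNeg≡0⇒≡0ˡ 0≤tf 0≤rest sum≡0)
    ∷ wsum-nonNeg≡0 L 0≤L 0≤f (nonNeg+nonNeg≡0⇒≡0ʳ 0≤tf 0≤rest sum≡0)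
    where
    0≤tf : 0ℚ ≤ t * f i
    0≤tf = *-nonNeg 0≤t (0≤f i)
    0≤rest : 0ℚ ≤ wsum L f
    0≤rest = wsum-nonNeg L 0≤L 0≤f

  module _ {L : List (ℚ × I)} (0≤L : NonNeg L) (weight≡1 : weight L ≡ 1ℚ) where

    wsum-const-convex : ∀ m → wsum L (λ _ → m) ≡ m
    wsum-const-convex m = trans (wsum-const L m) (trans (cong (m *_) weight≡1) (*-identityʳ m))

    wsum-sub-const : ∀ f m → wsum L (λ i → f i - m) ≡ wsum L f - m
    wsum-sub-const f m = trans (wsum-sub L f (λ _ → m)) (cong (λ u → wsum L f - u) (wsum-const-convex m))

    const-sub-wsum : ∀ m f → wsum L (λ i → m - f i) ≡ m - wsum L f
    const-sub-wsum m f = trans (wsum-sub L (λ _ → m) f) (cong (_- wsum L f) (wsum-const-convex m))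

    wsum-lowerBound : ∀ {f m} → (∀ i → m ≤ f i) → m ≤ wsum L f
    wsum-lowerBound {f} {m} m≤f =
      0≤q-p⇒p≤q (subst (0ℚ ≤_) (wsum-sub-const f m) (wsum-nonNeg L 0≤L (λ i → p≤q⇒0≤q-p (m≤f i))))

    wsum-upperBound : ∀ {f m} → (∀ i → f i ≤ m) → wsum L f ≤ m
    wsum-upperBound {f} {m} f≤m =
      0≤q-p⇒p≤q (subst (0ℚ ≤_) (const-sub-wsum m f) (wsum-nonNeg L 0≤L (λ i → p≤q⇒0≤q-p (f≤m i))))

    face-min : ∀ {f m} → (∀ i → m ≤ f i) → wsum L f ≡ m → OnSupport (λ i → f i ≡ m) L
    face-min {f} {m} m≤f wsum≡m = onSupport-map p-q≡0⇒p≡q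
      (wsum-nonNeg≡0 L 0≤L (λ i → p≤q⇒0≤q-p (m≤f i))
        (trans (wsum-sub-const f m) (trans (cong (_- m) wsum≡m) (+-inverseʳ m))))

    face-max : ∀ {f m} → (∀ i → f i ≤ m) → wsum L f ≡ m → OnSupport (λ i → f i ≡ m) L
    face-max {f} {m} f≤m wsum≡m = onSupport-map (λ m-fi≡0 → sym (p-q≡0⇒p≡q m-fi≡0))
      (wsum-nonNeg≡0 L 0≤L (λ i → p≤q⇒0≤q-p (f≤m i))
        (trans (const-sub-wsum m f) (trans (cong (λ u → m - u) wsum≡m) (+-inverseʳ m))))

    bit-average : ∀ {f} → (∀ i → f i ≡ 0ℚ ⊎ f i ≡ 1ℚ) → Trit (wsum L f) → OnSupport (λ i → f i ≡ wsum L f) L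
    bit-average {f} bit (inj₁ avg≡0) =
      onSupport-map (λ fi≡0 → trans fi≡0 (sym avg≡0)) (face-min (λ i → 0≤bit (bit i)) avg≡0)
      where
      0≤bit : ∀ {q} → q ≡ 0ℚ ⊎ q ≡ 1ℚ → 0ℚ ≤ q
      0≤bit (inj₁ refl) = ≤-refl
      0≤bit (inj₂ refl) = 0≤1
    bit-average {f} bit (inj₂ (inj₁ avg≡1)) =
      onSupport-map (λ fi≡1 → trans fi≡1 (sym avg≡1)) (face-max (λ i → bit≤1 (bit i)) avg≡1)
      where
      bit≤1 : ∀ {q} → q ≡ 0ℚ ⊎ q ≡ 1ℚ → q ≤ 1ℚ
      bit≤1 (inj₁ refl) = 0≤1
      bit≤1 (inj₂ refl) = ≤-refl
    bit-average {f} bit (inj₂ (inj₂ avg≡-1)) =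
      contradiction (subst (0ℚ ≤_) avg≡-1 (wsum-nonNeg L 0≤L 0≤f)) λ { (ℚ.*≤* ()) }
      where
      0≤f : ∀ i → 0ℚ ≤ f i
      0≤f i with bit i
      ... | inj₁ fi≡0 = ≤-reflexive (sym fi≡0)
      ... | inj₂ fi≡1 = subst (0ℚ ≤_) (sym fi≡1) 0≤1

  scale : ℚ → List (ℚ × I) → List (ℚ × I)
  scale c = List.map (λ w → c * proj₁ w , proj₂ w)

  wsum-scaleList : ∀ c L f → wsum (scale c L) f ≡ c * wsum L f
  wsum-scaleList c []            f = sym (*-zeroʳ c)
  wsum-scaleList c ((t , i) ∷ L) f =
    trans (cong (c * t * f i +_) (wsum-scaleList c L f))
          (trans (cong (_+ c * wsum L f) (*-assoc c t (f i))) (sym (*-distribˡ-+ c (t * f i) (wsum L f))))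

  weight-scale : ∀ c L → weight (scale c L) ≡ c * weight L
  weight-scale c []            = sym (*-zeroʳ c)
  weight-scale c ((t , i) ∷ L) = trans (cong (c * t +_) (weight-scale c L)) (sym (*-distribˡ-+ c t (weight L)))

  nonNeg-scale : ∀ {c} L → 0ℚ ≤ c → NonNeg L → NonNeg (scale c L)
  nonNeg-scale L 0≤c 0≤L = All.map⁺ (All.map (*-nonNeg 0≤c) 0≤L)

  onSupport-unscale : ∀ {c P} L → c ≢ 0ℚ → OnSupport P (scale c L) → OnSupport P L
  onSupport-unscale {c} L c≢0 on = All.map (Sum.map₁ unscale) (All.map⁻ on)
    where
    unscale : ∀ {t} → c * t ≡ 0ℚ → t ≡ 0ℚ
    unscale ct≡0 with p*q≡0⇒p≡0⊎q≡0 ct≡0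
    ... | inj₁ c≡0 = contradiction c≡0 c≢0
    ... | inj₂ t≡0 = t≡0

  wsum-++ : ∀ L M f → wsum (L ++ M) f ≡ wsum L f + wsum M f
  wsum-++ []            M f = sym (+-identityˡ (wsum M f))
  wsum-++ ((t , i) ∷ L) M f =
    trans (cong (t * f i +_) (wsum-++ L M f)) (sym (+-assoc (t * f i) (wsum L f) (wsum M f)))

  weight-++ : ∀ (L M : List (ℚ × I)) → weight (L ++ M) ≡ weight L + weight M
  weight-++ []            M = sym (+-identityˡ (weight M))
  weight-++ ((t , i) ∷ L) M = trans (cong (t +_) (weight-++ L M)) (sym (+-assoc t (weight L) (weight M)))

  weight-nonNeg : ∀ L → NonNeg L → 0ℚ ≤ weight L
  weight-nonNeg []            []           = ≤-refl
  weight-nonNeg ((t , i) ∷ L) (0≤t ∷ 0≤L) = +-nonNeg 0≤t (weight-nonNeg L 0≤L)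

  wsum-weight≡0 : ∀ L f → NonNeg L → weight L ≡ 0ℚ → wsum L f ≡ 0ℚ
  wsum-weight≡0 []            f []           _        = refl
  wsum-weight≡0 ((t , i) ∷ L) f (0≤t ∷ 0≤L) weight≡0 = begin
    t * f i + wsum L f    ≡⟨ cong₂ (λ u v → u * f i + v) t≡0 (wsum-weight≡0 L f 0≤L rest≡0) ⟩
    0ℚ * f i + 0ℚ         ≡⟨ trans (+-identityʳ _) (*-zeroˡ (f i)) ⟩
    0ℚ                    ∎
    where
    open ≡-Reasoning
    0≤rest : 0ℚ ≤ weight L
    0≤rest = weight-nonNeg L 0≤L
    t≡0 : t ≡ 0ℚ
    t≡0 = nonNeg+nonNeg≡0⇒≡0ˡ 0≤t 0≤rest weight≡0
    rest≡0 : weight L ≡ 0ℚ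
    rest≡0 = nonNeg+nonNeg≡0⇒≡0ʳ 0≤t 0≤rest weight≡0

  wsum-tabulate : ∀ {n} (F : Fin n → ℚ × I) f → wsum (List.tabulate F) f ≡ sum (λ r → proj₁ (F r) * f (proj₂ (F r)))
  wsum-tabulate {zero}  F f = refl
  wsum-tabulate {suc n} F f = cong (proj₁ (F zero) * f (proj₂ (F zero)) +_) (wsum-tabulate (F ∘ suc) f)

  weight-tabulate : ∀ {n} (F : Fin n → ℚ × I) → weight (List.tabulate F) ≡ sum (proj₁ ∘ F)
  weight-tabulate {zero}  F = refl
  weight-tabulate {suc n} F = cong (proj₁ (F zero) +_) (weight-tabulate (F ∘ suc))

  wsum-concat : ∀ {N} (Ls : Fin N → List (ℚ × I)) f → wsum (List.concat (List.tabulate Ls)) f ≡ sum (λ j → wsum (Ls j) f)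
  wsum-concat {zero}  Ls f = refl
  wsum-concat {suc N} Ls f = trans (wsum-++ (Ls zero) _ f) (cong (wsum (Ls zero) f +_) (wsum-concat (Ls ∘ suc) f))

  weight-concat : ∀ {N} (Ls : Fin N → List (ℚ × I)) → weight (List.concat (List.tabulate Ls)) ≡ sum (weight ∘ Ls)
  weight-concat {zero}  Ls = refl
  weight-concat {suc N} Ls = trans (weight-++ (Ls zero) _) (cong (weight (Ls zero) +_) (weight-concat (Ls ∘ suc)))

-- Convex hulls

lookup-ext : ∀ {n} {u v : Vec ℚ n} → (∀ j → lookup u j ≡ lookup v j) → u ≡ v
lookup-ext {u = u} {v} u≗v = trans (sym (tabulate∘lookup u)) (trans (tabulate-cong u≗v) (tabulate∘lookup v))

mix : ∀ {d} → ℚ → Vec ℚ d → Vec ℚ d → Vec ℚ d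
mix t y z = zipWith _+_ (Vec.map (t *_) y) (Vec.map ((1ℚ - t) *_) z)

lookup-mix : ∀ {d} t (y z : Vec ℚ d) j → lookup (mix t y z) j ≡ t * lookup y j + (1ℚ - t) * lookup z j
lookup-mix t y z j =
  trans (lookup-zipWith _+_ j (Vec.map (t *_) y) (Vec.map ((1ℚ - t) *_) z))
        (cong₂ _+_ (lookup-map j (t *_) y) (lookup-map j ((1ℚ - t) *_) z))

module _ {d} {I : Set} (g : I → Vec ℚ d) where

  lookup-combo : ∀ L j → lookup (combo g L) j ≡ wsum L (λ i → lookup (g i) j)
  lookup-combo []            j = lookup-replicate j 0ℚ
  lookup-combo ((t , i) ∷ L) j =
    trans (lookup-zipWith _+_ j (Vec.map (t *_) (g i)) (combo g L))
          (cong₂ _+_ (lookup-map j (t *_) (g i)) (lookup-combo L j))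

  combo-onSupport : ∀ {L v} → OnSupport (λ i → g i ≡ v) L → weight L ≡ 1ℚ → combo g L ≡ v
  combo-onSupport {L} {v} on weight≡1 = lookup-ext λ j → begin
    lookup (combo g L) j           ≡⟨ lookup-combo L j ⟩
    wsum L (λ i → lookup (g i) j)  ≡⟨ wsum-cong L (onSupport-map (cong (λ u → lookup u j)) on) ⟩
    wsum L (λ _ → lookup v j)      ≡⟨ wsum-const L (lookup v j) ⟩
    lookup v j * weight L          ≡⟨ cong (lookup v j *_) weight≡1 ⟩
    lookup v j * 1ℚ                ≡⟨ *-identityʳ (lookup v j) ⟩
    lookup v j                     ∎
    where open ≡-Reasoning

  generator∈conv : ∀ i → InConv g (g i)
  generator∈conv i = (1ℚ , i) ∷ [] , 0≤1 ∷ [] , refl , combo-onSupport (inj₂ refl ∷ []) refl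

  combo-++-scale : ∀ s t Ly Lz →
    combo g (scale s Ly ++ scale t Lz) ≡ zipWith _+_ (Vec.map (s *_) (combo g Ly)) (Vec.map (t *_) (combo g Lz))
  combo-++-scale s t Ly Lz = lookup-ext λ j → begin
    lookup (combo g (scale s Ly ++ scale t Lz)) j
      ≡⟨ lookup-combo (scale s Ly ++ scale t Lz) j ⟩
    wsum (scale s Ly ++ scale t Lz) (coord j)
      ≡⟨ wsum-++ (scale s Ly) (scale t Lz) (coord j) ⟩
    wsum (scale s Ly) (coord j) + wsum (scale t Lz) (coord j)
      ≡⟨ cong₂ _+_ (wsum-scaleList s Ly (coord j)) (wsum-scaleList t Lz (coord j)) ⟩
    s * wsum Ly (coord j) + t * wsum Lz (coord j)
      ≡⟨ cong₂ (λ u v → s * u + t * v) (lookup-combo Ly j) (lookup-combo Lz j) ⟨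
    s * lookup (combo g Ly) j + t * lookup (combo g Lz) j
      ≡⟨ cong₂ _+_ (lookup-map j (s *_) (combo g Ly)) (lookup-map j (t *_) (combo g Lz)) ⟨
    lookup (Vec.map (s *_) (combo g Ly)) j + lookup (Vec.map (t *_) (combo g Lz)) j
      ≡⟨ lookup-zipWith _+_ j (Vec.map (s *_) (combo g Ly)) (Vec.map (t *_) (combo g Lz)) ⟨
    lookup (zipWith _+_ (Vec.map (s *_) (combo g Ly)) (Vec.map (t *_) (combo g Lz))) j ∎
    where
    open ≡-Reasoning
    coord : Fin d → I → ℚ
    coord j i = lookup (g i) j

  Rigid : Vec ℚ d → Set
  Rigid x = ∀ L → NonNeg L → weight L ≡ 1ℚ → combo g L ≡ x → OnSupport (λ i → g i ≡ x) L

  rigid⇒vertex : ∀ {x} → InConv g x → Rigid x → IsVertex g x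
  rigid⇒vertex {x} x∈conv rigid = x∈conv , extreme
    where
    extreme : ∀ t y z → 0ℚ < t → t < 1ℚ → InConv g y → InConv g z → x ≡ mix t y z → y ≡ z
    extreme t _ _ 0<t t<1 (Ly , 0≤Ly , wy , refl) (Lz , 0≤Lz , wz , refl) x≡mix =
      trans (combo-onSupport (onSupport-unscale Ly t≢0 (proj₁ onM)) wy)
            (sym (combo-onSupport (onSupport-unscale Lz 1-t≢0 (proj₂ onM)) wz))
      where
      M : List (ℚ × I)
      M = scale t Ly ++ scale (1ℚ - t) Lz
      0<1-t : 0ℚ < 1ℚ - t
      0<1-t = p<q⇒0<q-p t<1
      t≢0 : t ≢ 0ℚ
      t≢0 = ≢-sym (<⇒≢ 0<t)
      1-t≢0 : 1ℚ - t ≢ 0ℚ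
      1-t≢0 = ≢-sym (<⇒≢ 0<1-t)
      0≤M : NonNeg M
      0≤M = All.++⁺ (nonNeg-scale Ly (<⇒≤ 0<t) 0≤Ly) (nonNeg-scale Lz (<⇒≤ 0<1-t) 0≤Lz)
      weight≡1 : weight M ≡ 1ℚ
      weight≡1 = begin
        weight M                                        ≡⟨ weight-++ (scale t Ly) (scale (1ℚ - t) Lz) ⟩
        weight (scale t Ly) + weight (scale (1ℚ - t) Lz) ≡⟨ cong₂ _+_ (weight-scale t Ly) (weight-scale (1ℚ - t) Lz) ⟩
        t * weight Ly + (1ℚ - t) * weight Lz           ≡⟨ cong₂ (λ u v → t * u + (1ℚ - t) * v) wy wz ⟩
        t * 1ℚ + (1ℚ - t) * 1ℚ                         ≡⟨ t+[1-t]≡1 t ⟩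
        1ℚ                                             ∎
        where
        open ≡-Reasoning
        t+[1-t]≡1 : ∀ t → t * 1ℚ + (1ℚ - t) * 1ℚ ≡ 1ℚ
        t+[1-t]≡1 = solve-∀ ℚ-ring
      onM : OnSupport (λ i → g i ≡ x) (scale t Ly) × OnSupport (λ i → g i ≡ x) (scale (1ℚ - t) Lz)
      onM = All.++⁻ (scale t Ly) (rigid M 0≤M weight≡1 (trans (combo-++-scale t (1ℚ - t) Ly Lz) (sym x≡mix)))

  mix-idem : ∀ t (y : Vec ℚ d) → mix t y y ≡ y
  mix-idem t y = lookup-ext λ j → trans (lookup-mix t y y j) (t+[1-t] t (lookup y j))
    where
    t+[1-t] : ∀ t a → t * a + (1ℚ - t) * a ≡ a
    t+[1-t] = solve-∀ ℚ-ring

  combo-drop-zero : ∀ i L → combo g ((0ℚ , i) ∷ L) ≡ combo g L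
  combo-drop-zero i L = lookup-ext λ j → begin
    lookup (combo g ((0ℚ , i) ∷ L)) j          ≡⟨ lookup-combo ((0ℚ , i) ∷ L) j ⟩
    0ℚ * lookup (g i) j + wsum L (coord j)     ≡⟨ trans (cong (_+ wsum L (coord j)) (*-zeroˡ (lookup (g i) j))) (+-identityˡ _) ⟩
    wsum L (coord j)                           ≡⟨ lookup-combo L j ⟨
    lookup (combo g L) j                       ∎
    where
    open ≡-Reasoning
    coord : Fin d → I → ℚ
    coord j i = lookup (g i) j

  combo-head : ∀ i L → NonNeg L → weight L ≡ 0ℚ → combo g ((1ℚ , i) ∷ L) ≡ g i
  combo-head i L 0≤L weight≡0 = lookup-ext λ j → begin
    lookup (combo g ((1ℚ , i) ∷ L)) j          ≡⟨ lookup-combo ((1ℚ , i) ∷ L) j ⟩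
    1ℚ * lookup (g i) j + wsum L (coord j)     ≡⟨ cong (1ℚ * lookup (g i) j +_) (wsum-weight≡0 L (coord j) 0≤L weight≡0) ⟩
    1ℚ * lookup (g i) j + 0ℚ                   ≡⟨ trans (+-identityʳ _) (*-identityˡ _) ⟩
    lookup (g i) j                             ∎
    where
    open ≡-Reasoning
    coord : Fin d → I → ℚ
    coord j i = lookup (g i) j

  combo-split : ∀ t i L → NonNeg L → weight L ≡ 1ℚ - t → t < 1ℚ →
                Σ (Vec ℚ d) (λ z → InConv g z × combo g ((t , i) ∷ L) ≡ mix t (g i) z)
  combo-split t i L 0≤L weight≡1-t t<1 = combo g (scale s L) , z∈conv , lookup-ext split
    where
    instance
      1-t-positive : ℚ.Positive (1ℚ - t)
      1-t-positive = ℚ.positive (p<q⇒0<q-p t<1)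
      1-t-nonZero : ℚ.NonZero (1ℚ - t)
      1-t-nonZero = pos⇒nonZero (1ℚ - t)
    s : ℚ
    s = 1/ (1ℚ - t)
    z∈conv : InConv g (combo g (scale s L))
    z∈conv = scale s L , nonNeg-scale L (<⇒≤ (1/pos>0 (1ℚ - t))) 0≤L ,
             trans (weight-scale s L) (trans (cong (s *_) weight≡1-t) (*-inverseˡ (1ℚ - t))) , refl
    coord : Fin d → I → ℚ
    coord j i = lookup (g i) j
    rescale : ∀ w → (1ℚ - t) * (s * w) ≡ w
    rescale w = trans (sym (*-assoc (1ℚ - t) s w)) (trans (cong (_* w) (*-inverseʳ (1ℚ - t))) (*-identityˡ w))
    split : ∀ j → lookup (combo g ((t , i) ∷ L)) j ≡ lookup (mix t (g i) (combo g (scale s L))) j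
    split j = begin
      lookup (combo g ((t , i) ∷ L)) j                        ≡⟨ lookup-combo ((t , i) ∷ L) j ⟩
      t * lookup (g i) j + wsum L (coord j)                   ≡⟨ cong (t * lookup (g i) j +_) (rescale (wsum L (coord j))) ⟨
      t * lookup (g i) j + (1ℚ - t) * (s * wsum L (coord j))
        ≡⟨ cong (λ u → t * lookup (g i) j + (1ℚ - t) * u) (trans (lookup-combo (scale s L) j) (wsum-scaleList s L (coord j))) ⟨
      t * lookup (g i) j + (1ℚ - t) * lookup (combo g (scale s L)) j
        ≡⟨ lookup-mix t (g i) (combo g (scale s L)) j ⟨
      lookup (mix t (g i) (combo g (scale s L))) j            ∎
      where open ≡-Reasoning

  vertex⇒generator : ∀ {x} → IsVertex g x → Σ I (λ i → g i ≡ x)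
  vertex⇒generator {x} ((L , 0≤L , weight≡1 , combo≡x) , extreme) = go L 0≤L weight≡1 combo≡x
    where
    go : ∀ L → NonNeg L → weight L ≡ 1ℚ → combo g L ≡ x → Σ I (λ i → g i ≡ x)
    go []            []           0≡1      _       = contradiction (sym 0≡1) 1≢0
    go ((t , i) ∷ L) (0≤t ∷ 0≤L) weight≡1 combo≡x with t ≟ 0ℚ | t ≟ 1ℚ
    ... | yes refl | _        = go L 0≤L (trans (sym (+-identityˡ (weight L))) weight≡1) (trans (sym (combo-drop-zero i L)) combo≡x)
    ... | no _     | yes refl = i , trans (sym (combo-head i L 0≤L (p+q≡r⇒q≡r-p {p = 1ℚ} weight≡1))) combo≡x
    ... | no t≢0   | no t≢1   = i , via-split (combo-split t i L 0≤L rest≡1-t t<1)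
      where
      rest≡1-t : weight L ≡ 1ℚ - t
      rest≡1-t = p+q≡r⇒q≡r-p {p = t} weight≡1
      t<1 : t < 1ℚ
      t<1 = ≤∧≢⇒< (0≤q-p⇒p≤q (subst (0ℚ ≤_) rest≡1-t (weight-nonNeg L 0≤L))) t≢1
      via-split : Σ (Vec ℚ d) (λ z → InConv g z × combo g ((t , i) ∷ L) ≡ mix t (g i) z) → g i ≡ x
      via-split (z , z∈conv , split) = begin
        g i               ≡⟨ mix-idem t (g i) ⟨
        mix t (g i) (g i) ≡⟨ cong (mix t (g i)) gi≡z ⟩
        mix t (g i) z     ≡⟨ trans (sym split) combo≡x ⟩
        x                 ∎
        where
        open ≡-Reasoning
        gi≡z : g i ≡ z
        gi≡z = extreme t (g i) z (≤∧≢⇒< 0≤t (≢-sym t≢0)) t<1 (generator∈conv i) z∈conv (trans (sym combo≡x) split)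

  sign-face : ∀ {L x} → NonNeg L → weight L ≡ 1ℚ → combo g L ≡ x → ∀ j → (∀ i → Trit (lookup (g i) j)) →
              Sign (lookup x j) → OnSupport (λ i → lookup (g i) j ≡ lookup x j) L
  sign-face {L} {x} 0≤L weight≡1 refl j trit sign =
    onSupport-map (λ xj·gi≡1 → sign-*-cancelˡ sign (trans xj·gi≡1 (sym (sign-square sign))))
                  (face-max 0≤L weight≡1 (λ i → trit⇒≤1 (trit-* (inj₂ sign) (trit i))) average≡1)
    where
    xj : ℚ
    xj = lookup x j
    average≡1 : wsum L (λ i → xj * lookup (g i) j) ≡ 1ℚ
    average≡1 = trans (wsum-scale L xj _) (trans (cong (xj *_) (sym (lookup-combo L j))) (sign-square sign))

  conv-trit-bounds : ∀ {x} → InConv g x → ∀ j → (∀ i → Trit (lookup (g i) j)) → - 1ℚ ≤ lookup x j × lookup x j ≤ 1ℚ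
  conv-trit-bounds (L , 0≤L , weight≡1 , refl) j trit =
    subst (- 1ℚ ≤_) (sym (lookup-combo L j)) (wsum-lowerBound 0≤L weight≡1 (λ i → trit⇒-1≤ (trit i))) ,
    subst (_≤ 1ℚ) (sym (lookup-combo L j)) (wsum-upperBound 0≤L weight≡1 (λ i → trit⇒≤1 (trit i)))

  conv-combination : ∀ {N} (w : Fin N → ℚ) (z : Fin N → Vec ℚ d) → (∀ j → 0ℚ ≤ w j) → sum w ≡ 1ℚ →
                     (∀ j → InConv g (z j)) → ∀ {y} → (∀ J → lookup y J ≡ sum (λ j → w j * lookup (z j) J)) → InConv g y
  conv-combination w z 0≤w sum≡1 z∈conv {y} y≡ = M , 0≤M , weight≡1 , lookup-ext combo≡y
    where
    Lz : ∀ j → List (ℚ × I)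
    Lz j = proj₁ (z∈conv j)
    Ls : Fin _ → List (ℚ × I)
    Ls j = scale (w j) (Lz j)
    M : List (ℚ × I)
    M = List.concat (List.tabulate Ls)
    0≤M : NonNeg M
    0≤M = All.concat⁺ (All.tabulate⁺ (λ j → nonNeg-scale (Lz j) (0≤w j) (proj₁ (proj₂ (z∈conv j)))))
    weight≡1 : weight M ≡ 1ℚ
    weight≡1 = trans (weight-concat Ls) (trans (sum-cong-≗ weight≡w) sum≡1)
      where
      weight≡w : ∀ j → weight (Ls j) ≡ w j
      weight≡w j = trans (weight-scale (w j) (Lz j)) (trans (cong (w j *_) (proj₁ (proj₂ (proj₂ (z∈conv j))))) (*-identityʳ (w j)))
    combo≡y : ∀ J → lookup (combo g M) J ≡ lookup y J
    combo≡y J = begin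
      lookup (combo g M) J                               ≡⟨ lookup-combo M J ⟩
      wsum M (λ i → lookup (g i) J)                      ≡⟨ wsum-concat Ls _ ⟩
      sum (λ j → wsum (Ls j) (λ i → lookup (g i) J))     ≡⟨ sum-cong-≗ (λ j → wsum-scaleList (w j) (Lz j) _) ⟩
      sum (λ j → w j * wsum (Lz j) (λ i → lookup (g i) J)) ≡⟨ sum-cong-≗ (λ j → cong (w j *_) (sym (lookup-combo (Lz j) J))) ⟩
      sum (λ j → w j * lookup (combo g (Lz j)) J)         ≡⟨ sum-cong-≗ (λ j → cong (λ v → w j * lookup v J) (proj₂ (proj₂ (proj₂ (z∈conv j))))) ⟩
      sum (λ j → w j * lookup (z j) J)                    ≡⟨ y≡ J ⟨
      lookup y J                                          ∎
      where open ≡-Reasoning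

module _ {I J : Set} where

  reindex : (I → J) → List (ℚ × I) → List (ℚ × J)
  reindex h = List.map (λ w → proj₁ w , h (proj₂ w))

  weight-reindex : ∀ h L → weight (reindex h L) ≡ weight L
  weight-reindex h []            = refl
  weight-reindex h ((t , i) ∷ L) = cong (t +_) (weight-reindex h L)

  combo-reindex : ∀ {d} (g : J → Vec ℚ d) h L → combo g (reindex h L) ≡ combo (g ∘ h) L
  combo-reindex g h []            = refl
  combo-reindex g h ((t , i) ∷ L) = cong (Vec.zipWith _+_ (Vec.map (t *_) (g (h i)))) (combo-reindex g h L)

  conv-reindex : ∀ {d} (g : J → Vec ℚ d) h {x} → InConv (g ∘ h) x → InConv g x
  conv-reindex g h (L , 0≤L , weight≡1 , combo≡x) =
    reindex h L , All.map⁺ 0≤L , trans (weight-reindex h L) weight≡1 , trans (combo-reindex g h L) combo≡x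

zero⊎nonzero : ∀ {n} (x : Vec ℚ n) → x ≡ replicate n 0ℚ ⊎ Σ (Fin n) (λ j → lookup x j ≢ 0ℚ)
zero⊎nonzero []      = inj₁ refl
zero⊎nonzero (q ∷ x) with q ≟ 0ℚ | zero⊎nonzero x
... | no q≢0   | _               = inj₂ (zero , q≢0)
... | yes refl | inj₁ refl       = inj₁ refl
... | yes refl | inj₂ (j , xj≢0) = inj₂ (suc j , xj≢0)

-- The simplex C_p

-- simplexGen p b is a tabulation; naming the tabulated function lets `with` reach its clauses.
tabulated : ∀ {n} {f : Fin n → ℚ} (v : Vec ℚ n) → v ≡ Vec.tabulate f → Fin n → ℚ
tabulated {f = f} _ _ = f

entry : ∀ {p} → Fin p → Fin (p ∸ 1) → ℚ
entry {p} b = tabulated (simplexGen p b) refl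

lookup-simplexGen : ∀ {p} (b : Fin p) r → lookup (simplexGen p b) r ≡ entry b r
lookup-simplexGen b r = lookup∘tabulate (entry b) r

entry-fromℕ : ∀ {n} (r : Fin n) → entry (fromℕ n) r ≡ - 1ℚ
entry-fromℕ {n} r with toℕ (fromℕ n) ℕ.≟ n
... | yes _  = refl
... | no ≢n = contradiction (toℕ-fromℕ n) ≢n

entry-inject₁ : ∀ {n} (s r : Fin n) → entry (inject₁ s) r ≡ δ s r
entry-inject₁ {n} s r with toℕ (inject₁ s) ℕ.≟ n
... | yes ≡n = contradiction (sym ≡n) (toℕ-inject₁-≢ s)
... | no _ with toℕ r ℕ.≟ toℕ (inject₁ s) | s Fin.≟ r
...   | yes _   | yes _    = refl
...   | yes r≡s | no s≢r   = contradiction (toℕ-injective (trans (sym (toℕ-inject₁ s)) (sym r≡s))) s≢r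
...   | no r≢s  | yes refl = contradiction (sym (toℕ-inject₁ s)) r≢s
...   | no _    | no _     = refl

isLast : ∀ {p} → Fin p → ℚ
isLast {suc n} b with view b
... | ‵fromℕ     = 1ℚ
... | ‵inject₁ _ = 0ℚ

isLast-bit : ∀ {p} (b : Fin p) → isLast b ≡ 0ℚ ⊎ isLast b ≡ 1ℚ
isLast-bit {suc n} b with view b
... | ‵fromℕ     = inj₂ refl
... | ‵inject₁ _ = inj₁ refl

private
  nonzero-entry : ∀ {n} (b : Fin (suc n)) r → entry b r ≢ 0ℚ →
                  b ≡ fromℕ n × isLast b ≡ 1ℚ × entry b r ≡ - 1ℚ
                  ⊎ b ≡ inject₁ r × isLast b ≡ 0ℚ × entry b r ≡ 1ℚ
  nonzero-entry b r entry≢0 with view b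
  ... | ‵fromℕ     = inj₁ (refl , refl , entry-fromℕ r)
  ... | ‵inject₁ s with s Fin.≟ r
  ...   | yes refl = inj₂ (refl , refl , trans (entry-inject₁ s s) (δ-diag s))
  ...   | no s≢r   = contradiction (trans (entry-inject₁ s r) (δ-off s≢r)) entry≢0

entry-trit : ∀ {p} (b : Fin p) r → Trit (entry b r)
entry-trit {suc n} b r with entry b r ≟ 0ℚ
... | yes entry≡0 = inj₁ entry≡0
... | no  entry≢0 with nonzero-entry b r entry≢0
...   | inj₁ (_ , _ , entry≡-1) = inj₂ (inj₂ entry≡-1)
...   | inj₂ (_ , _ , entry≡1)  = inj₂ (inj₁ entry≡1)

entry-injective : ∀ {p} (b b′ : Fin p) r → entry b r ≡ entry b′ r → entry b r ≢ 0ℚ → b ≡ b′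
entry-injective {suc n} b b′ r same entry≢0
  with nonzero-entry b r entry≢0 | nonzero-entry b′ r (λ ≡0 → entry≢0 (trans same ≡0))
... | inj₁ (refl , _) | inj₁ (refl , _) = refl
... | inj₂ (refl , _) | inj₂ (refl , _) = refl
... | inj₁ (_ , _ , ≡-1) | inj₂ (_ , _ , ≡1) = contradiction (trans (sym ≡-1) (trans same ≡1)) λ ()
... | inj₂ (_ , _ , ≡1) | inj₁ (_ , _ , ≡-1) = contradiction (trans (sym ≡-1) (trans (sym same) ≡1)) λ ()

entry-isLast-injective : ∀ {p} (b b′ : Fin p) r → entry b r ≢ 0ℚ → entry b′ r ≢ 0ℚ → isLast b ≡ isLast b′ → b ≡ b′
entry-isLast-injective {suc n} b b′ r entry≢0 entry′≢0 same with nonzero-entry b r entry≢0 | nonzero-entry b′ r entry′≢0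
... | inj₁ (refl , _) | inj₁ (refl , _) = refl
... | inj₂ (refl , _) | inj₂ (refl , _) = refl
... | inj₁ (_ , last , _) | inj₂ (_ , last′ , _) = contradiction (trans (sym last) (trans same last′)) 1≢0
... | inj₂ (_ , last , _) | inj₁ (_ , last′ , _) = contradiction (trans (sym last′) (trans (sym same) last)) 1≢0

entry-off : ∀ {p} (b : Fin p) {r r′} → r′ ≢ r → entry b r ≢ 0ℚ → entry b r′ ≡ entry b r * isLast b
entry-off {suc n} b {r} {r′} r′≢r entry≢0 with nonzero-entry b r entry≢0
... | inj₁ (refl , last , entry≡-1) = begin
  entry (fromℕ n) r′           ≡⟨ entry-fromℕ r′ ⟩
  - 1ℚ                         ≡⟨ cong₂ _*_ entry≡-1 last ⟨
  entry (fromℕ n) r * isLast (fromℕ n) ∎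
  where open ≡-Reasoning
... | inj₂ (refl , last , _) = begin
  entry (inject₁ r) r′         ≡⟨ trans (entry-inject₁ r r′) (δ-off (r′≢r ∘ sym)) ⟩
  0ℚ                           ≡⟨ trans (cong (entry (inject₁ r) r *_) last) (*-zeroʳ (entry {suc n} (inject₁ r) r)) ⟨
  entry (inject₁ r) r * isLast (inject₁ r) ∎
  where open ≡-Reasoning

entry-sign : ∀ {p} → 2 ℕ.≤ p → (b : Fin p) → Σ (Fin (p ∸ 1)) (λ r → Sign (entry b r))
entry-sign {suc (suc n)} (s≤s (s≤s z≤n)) b with view b
... | ‵fromℕ     = zero , inj₂ (entry-fromℕ {suc n} zero)
... | ‵inject₁ s = s , inj₁ (trans (entry-inject₁ s s) (δ-diag s))

another : ∀ {p} → 3 ℕ.≤ p → (r : Fin (p ∸ 1)) → Σ (Fin (p ∸ 1)) (λ r′ → r′ ≢ r)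
another {suc (suc (suc n))} (s≤s (s≤s (s≤s z≤n))) zero    = suc zero , λ ()
another {suc (suc (suc n))} (s≤s (s≤s (s≤s z≤n))) (suc r) = zero , λ ()

simplex-vertex : ∀ {p} → 2 ℕ.≤ p → ∀ b → IsVertex (simplexGen p) (simplexGen p b)
simplex-vertex {p} 2≤p b = rigid⇒vertex (simplexGen p) (generator∈conv (simplexGen p) b) rigid
  where
  r : Fin (p ∸ 1)
  r = proj₁ (entry-sign 2≤p b)
  trit : ∀ b′ → Trit (lookup (simplexGen p b′) r)
  trit b′ = subst Trit (sym (lookup-simplexGen b′ r)) (entry-trit b′ r)
  sign : Sign (lookup (simplexGen p b) r)
  sign = subst Sign (sym (lookup-simplexGen b r)) (proj₂ (entry-sign 2≤p b))
  same-vertex : ∀ {b′} → lookup (simplexGen p b′) r ≡ lookup (simplexGen p b) r → simplexGen p b′ ≡ simplexGen p b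
  same-vertex {b′} same = cong (simplexGen p) (entry-injective b′ b r same′ (sign⇒≢0 (subst Sign same′′ sign)))
    where
    same′ : entry b′ r ≡ entry b r
    same′ = trans (sym (lookup-simplexGen b′ r)) (trans same (lookup-simplexGen b r))
    same′′ : lookup (simplexGen p b) r ≡ entry b′ r
    same′′ = trans (sym same) (lookup-simplexGen b′ r)
  rigid : Rigid (simplexGen p) (simplexGen p b)
  rigid L 0≤L weight≡1 combo≡b =
    onSupport-map (λ {b′} → same-vertex {b′}) (sign-face (simplexGen p) 0≤L weight≡1 combo≡b r trit sign)

module _ {n} (u : Vec ℚ n) where

  lastWeight : ℚ
  lastWeight = (1ℚ - sum (lookup u)) * 1/ℕ (suc n)

  -- The barycentric coordinates of u: u = ∑ᵣ (uᵣ + β) eᵣ + β (-∑ᵣ eᵣ) with β = lastWeight.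
  barycentric : List (ℚ × Fin (suc n))
  barycentric = (lastWeight , fromℕ n) ∷ List.tabulate (λ r → lookup u r + lastWeight , inject₁ r)

  weight-barycentric : weight barycentric ≡ 1ℚ
  weight-barycentric = begin
    β + weight (List.tabulate F)    ≡⟨ cong (β +_) (trans (weight-tabulate F) (∑-distrib-+ (lookup u) (λ (_ : Fin n) → β))) ⟩
    β + (S + sum {n} (λ _ → β))     ≡⟨ cong (λ x → β + (S + x)) (sum-replicate n {β}) ⟩
    β + (S + n · β)                 ≡⟨ regroup β S (n · β) ⟩
    suc n · β + S                   ≡⟨ cong (_+ S) (trans (n·x≡[n·1]*x (suc n) β) (1/ℕ-cancel (suc n) (1ℚ - S))) ⟩
    1ℚ - S + S                      ≡⟨ 1-s+s≡1 S ⟩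
    1ℚ                              ∎
    where
    open ≡-Reasoning
    β S : ℚ
    β = lastWeight
    S = sum (lookup u)
    F : Fin n → ℚ × Fin (suc n)
    F r = lookup u r + β , inject₁ r
    regroup : ∀ a b c → a + (b + c) ≡ a + c + b
    regroup = solve-∀ ℚ-ring
    1-s+s≡1 : ∀ s → 1ℚ - s + s ≡ 1ℚ
    1-s+s≡1 = solve-∀ ℚ-ring

  combo-barycentric : combo (simplexGen (suc n)) barycentric ≡ u
  combo-barycentric = lookup-ext λ r′ → begin
    lookup (combo (simplexGen (suc n)) barycentric) r′
      ≡⟨ trans (lookup-combo (simplexGen (suc n)) barycentric r′)
               (wsum-cong barycentric (everywhere (λ b → lookup-simplexGen b r′) barycentric)) ⟩
    β * entry (fromℕ n) r′ + wsum (List.tabulate F) (λ b → entry b r′)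
      ≡⟨ cong₂ (λ x y → β * x + y) (entry-fromℕ r′) (wsum-tabulate F (λ b → entry b r′)) ⟩
    β * - 1ℚ + sum (λ r → (lookup u r + β) * entry (inject₁ r) r′)
      ≡⟨ cong (β * - 1ℚ +_) (trans (sum-cong-≗ (λ r → cong ((lookup u r + β) *_) (entry-inject₁ r r′)))
                                    (sum-δ (λ r → lookup u r + β) r′)) ⟩
    β * - 1ℚ + (lookup u r′ + β)
      ≡⟨ cancel β (lookup u r′) ⟩
    lookup u r′                   ∎
    where
    open ≡-Reasoning
    β : ℚ
    β = lastWeight
    F : Fin n → ℚ × Fin (suc n)
    F r = lookup u r + β , inject₁ r
    cancel : ∀ b x → b * - 1ℚ + (x + b) ≡ x
    cancel = solve-∀ ℚ-ring

simplex-box : ∀ {p} → 2 ℕ.≤ p →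
              Σ ℚ (λ η → 0ℚ < η × (∀ u → (∀ r → ∣ lookup u r ∣ ≤ η) → InConv (simplexGen p) u))
simplex-box {suc (suc m)} (s≤s (s≤s z≤n)) =
  η , 0<η , λ u ∣u∣≤η → barycentric u , nonNeg u ∣u∣≤η , weight-barycentric u , combo-barycentric u
  where
  n : ℕ
  n = suc m
  η : ℚ
  η = ½ * 1/ℕ (suc n)
  0<η : 0ℚ < η
  0<η = subst (_< η) (*-zeroʳ ½) (*-monoʳ-<-pos ½ (1/ℕ-positive (suc n)))
  nonNeg : ∀ u → (∀ r → ∣ lookup u r ∣ ≤ η) → NonNeg (barycentric u)
  nonNeg u ∣u∣≤η = ≤-trans (<⇒≤ 0<η) η≤β ∷ All.tabulate⁺ {f = λ r → lookup u r + β , inject₁ r} λ r →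
                     subst (_≤ lookup u r + β) (+-inverseˡ η) (+-mono-≤ (proj₁ (∣p∣≤q⇒-q≤p≤q (∣u∣≤η r))) η≤β)
    where
    β S : ℚ
    β = lastWeight u
    S = sum (lookup u)
    S≤½ : S ≤ ½
    S≤½ = begin
      S                  ≤⟨ sum-mono-≤ {g = λ (_ : Fin n) → η} (λ r → proj₂ (∣p∣≤q⇒-q≤p≤q (∣u∣≤η r))) ⟩
      sum {n} (λ _ → η)  ≡⟨ sum-replicate n {η} ⟩
      n · η              ≤⟨ subst (_≤ η + n · η) (+-identityˡ (n · η)) (+-monoˡ-≤ (n · η) (<⇒≤ 0<η)) ⟩
      suc n · η          ≡⟨ trans (n·x≡[n·1]*x (suc n) η) (1/ℕ-cancel (suc n) ½) ⟩
      ½                  ∎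
      where open ≤-Reasoning
    η≤β : η ≤ β
    η≤β = 0≤q-p⇒p≤q (subst (0ℚ ≤_) (sym (β-η S (1/ℕ (suc n))))
                              (*-nonNeg (p≤q⇒0≤q-p S≤½) (<⇒≤ (1/ℕ-positive (suc n)))))
      where
      β-η : ∀ s i → (1ℚ - s) * i - ½ * i ≡ (½ - s) * i
      β-η = solve-∀ ℚ-ring

-- Tensor coordinates

∏ : ∀ {k} → (Fin k → ℚ) → ℚ
∏ {zero}  f = 1ℚ
∏ {suc k} f = f zero * ∏ (f ∘ suc)

∏-cong : ∀ {k} {f g : Fin k → ℚ} → (∀ i → f i ≡ g i) → ∏ f ≡ ∏ g
∏-cong {zero}  f≗g = refl
∏-cong {suc k} f≗g = cong₂ _*_ (f≗g zero) (∏-cong (f≗g ∘ suc))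

∏-sign : ∀ {k} {f : Fin k → ℚ} → (∀ i → Sign (f i)) → Sign (∏ f)
∏-sign {zero}  _    = inj₁ refl
∏-sign {suc k} sign = sign-* (sign zero) (∏-sign (sign ∘ suc))

∏-trit : ∀ {k} {f : Fin k → ℚ} → (∀ i → Trit (f i)) → Trit (∏ f)
∏-trit {zero}  _    = inj₂ (inj₁ refl)
∏-trit {suc k} trit = trit-* (trit zero) (∏-trit (trit ∘ suc))

∏-split : ∀ {k} (f g : Fin k → ℚ) i → (∀ j → j ≢ i → f j ≡ g j) →
          Σ ℚ (λ R → ∏ f ≡ f i * R × ∏ g ≡ g i * R)
∏-split {suc k} f g zero    f≗g = ∏ (f ∘ suc) , refl , cong (g zero *_) (∏-cong λ j → sym (f≗g (suc j) λ ()))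
∏-split {suc k} f g (suc i) f≗g with ∏-split (f ∘ suc) (g ∘ suc) i (λ j j≢i → f≗g (suc j) (j≢i ∘ suc-injective))
... | R , ∏f≡ , ∏g≡ = f zero * R , trans (cong (f zero *_) ∏f≡) (swap (f zero) (f (suc i)) R)
                                 , trans (cong₂ _*_ (sym (f≗g zero λ ())) ∏g≡) (swap (f zero) (g (suc i)) R)
  where
  swap : ∀ a b c → a * (b * c) ≡ b * (a * c)
  swap = solve-∀ ℚ-ring

∏-factor-≢0 : ∀ {k} (f : Fin k → ℚ) i → ∏ f ≢ 0ℚ → f i ≢ 0ℚ
∏-factor-≢0 f i ∏≢0 fi≡0 with ∏-split f f i (λ _ _ → refl)
... | R , ∏f≡ , _ = ∏≢0 (trans ∏f≡ (trans (cong (_* R) fi≡0) (*-zeroˡ R)))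

updateᵈ : ∀ {k} {A : Fin k → Set} → ((i : Fin k) → A i) → (i : Fin k) → A i → (j : Fin k) → A j
updateᵈ f zero    x zero    = x
updateᵈ f zero    x (suc j) = f (suc j)
updateᵈ f (suc i) x zero    = f zero
updateᵈ f (suc i) x (suc j) = updateᵈ (f ∘ suc) i x j

updateᵈ-same : ∀ {k} {A : Fin k → Set} (f : (i : Fin k) → A i) i x → updateᵈ f i x i ≡ x
updateᵈ-same f zero    x = refl
updateᵈ-same f (suc i) x = updateᵈ-same (f ∘ suc) i x

updateᵈ-other : ∀ {k} {A : Fin k → Set} (f : (i : Fin k) → A i) i x j → j ≢ i → updateᵈ f i x j ≡ f j
updateᵈ-other f zero    x zero    j≢i = contradiction refl j≢i
updateᵈ-other f zero    x (suc j) _   = refl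
updateᵈ-other f (suc i) x zero    _   = refl
updateᵈ-other f (suc i) x (suc j) j≢i = updateᵈ-other (f ∘ suc) i x j (j≢i ∘ cong suc)

-- A generator of C_m is given by a Choice of vertex of each C_{pᵢ}; a coordinate of ℝ^{φ(m)} by a
-- MultiIndex, flattened in the order used by kron.
Choice : ∀ {k} → Vec ℕ k → Set
Choice {k} ps = (i : Fin k) → Fin (lookup ps i)

MultiIndex : ∀ {k} → Vec ℕ k → Set
MultiIndex {k} ps = (i : Fin k) → Fin (lookup ps i ∸ 1)

flatten : ∀ {k} (ps : Vec ℕ k) → MultiIndex ps → Fin (dim ps)
flatten []       a = zero
flatten (p ∷ ps) a = Fin.combine (a zero) (flatten ps (a ∘ suc))

unflatten : ∀ {k} (ps : Vec ℕ k) → Fin (dim ps) → MultiIndex ps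
unflatten (p ∷ ps) j zero    = proj₁ (Fin.remQuot {p ∸ 1} (dim ps) j)
unflatten (p ∷ ps) j (suc i) = unflatten ps (proj₂ (Fin.remQuot {p ∸ 1} (dim ps) j)) i

flatten-unflatten : ∀ {k} (ps : Vec ℕ k) j → flatten ps (unflatten ps j) ≡ j
flatten-unflatten []       zero = refl
flatten-unflatten (p ∷ ps) j    =
  trans (cong (Fin.combine r) (flatten-unflatten ps s)) (combine-remQuot {p ∸ 1} (dim ps) j)
  where
  r : Fin (p ∸ 1)
  r = proj₁ (Fin.remQuot {p ∸ 1} (dim ps) j)
  s : Fin (dim ps)
  s = proj₂ (Fin.remQuot {p ∸ 1} (dim ps) j)

lookup-kron : ∀ {m n} (v : Vec ℚ m) (w : Vec ℚ n) r s → lookup (kron v w) (Fin.combine r s) ≡ lookup v r * lookup w s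
lookup-kron v w r s = trans (lookup-concat (Vec.map (λ x → Vec.map (x *_) w) v) r s)
  (trans (cong (λ u → lookup u s) (lookup-map r (λ x → Vec.map (x *_) w) v)) (lookup-map s (lookup v r *_) w))

lookup-tensor : ∀ {k} (ps : Vec ℕ k) vs a → lookup (tensor ps vs) (flatten ps a) ≡ ∏ (λ i → lookup (vs i) (a i))
lookup-tensor []       vs a = refl
lookup-tensor (p ∷ ps) vs a = trans (lookup-kron (vs zero) (tensor ps (vs ∘ suc)) (a zero) (flatten ps (a ∘ suc)))
  (cong (lookup (vs zero) (a zero) *_) (lookup-tensor ps (vs ∘ suc) (a ∘ suc)))

lookup-cycloGen : ∀ {k} (ps : Vec ℕ k) c a → lookup (cycloGen ps c) (flatten ps a) ≡ ∏ (λ i → entry (c i) (a i))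
lookup-cycloGen ps c a = trans (lookup-tensor ps _ a) (∏-cong λ i → lookup-simplexGen (c i) (a i))

tensor-cong : ∀ {k} (ps : Vec ℕ k) {vs ws} → (∀ i → vs i ≡ ws i) → tensor ps vs ≡ tensor ps ws
tensor-cong []       vs≗ws = refl
tensor-cong (p ∷ ps) vs≗ws = cong₂ kron (vs≗ws zero) (tensor-cong ps (vs≗ws ∘ suc))

cycloGen-cong : ∀ {k} (ps : Vec ℕ k) {c c′ : Choice ps} → (∀ i → c i ≡ c′ i) → cycloGen ps c ≡ cycloGen ps c′
cycloGen-cong ps c≗c′ = tensor-cong ps (λ i → cong (simplexGen (lookup ps i)) (c≗c′ i))

kron-combo : ∀ {I : Set} {m n} (g : I → Vec ℚ m) L (w : Vec ℚ n) → combo (λ i → kron (g i) w) L ≡ kron (combo g L) w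
kron-combo {m = m} {n} g L w = lookup-ext at
  where
  at : ∀ j → lookup (combo (λ i → kron (g i) w) L) j ≡ lookup (kron (combo g L) w) j
  at j = begin
    lookup (combo (λ i → kron (g i) w) L) j
      ≡⟨ cong (lookup (combo (λ i → kron (g i) w) L)) (combine-remQuot {m} n j) ⟨
    lookup (combo (λ i → kron (g i) w) L) (Fin.combine r s)
      ≡⟨ lookup-combo (λ i → kron (g i) w) L (Fin.combine r s) ⟩
    wsum L (λ i → lookup (kron (g i) w) (Fin.combine r s))
      ≡⟨ wsum-cong L (everywhere (λ i → trans (lookup-kron (g i) w r s) (*-comm (lookup (g i) r) (lookup w s))) L) ⟩
    wsum L (λ i → lookup w s * lookup (g i) r)
      ≡⟨ wsum-scale L (lookup w s) (λ i → lookup (g i) r) ⟩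
    lookup w s * wsum L (λ i → lookup (g i) r)
      ≡⟨ trans (cong (_* lookup w s) (lookup-combo g L r)) (*-comm (wsum L (λ i → lookup (g i) r)) (lookup w s)) ⟨
    lookup (combo g L) r * lookup w s
      ≡⟨ lookup-kron (combo g L) w r s ⟨
    lookup (kron (combo g L) w) (Fin.combine r s)
      ≡⟨ cong (lookup (kron (combo g L) w)) (combine-remQuot {m} n j) ⟩
    lookup (kron (combo g L) w) j ∎
    where
    open ≡-Reasoning
    r : Fin m
    r = proj₁ (Fin.remQuot {m} n j)
    s : Fin n
    s = proj₂ (Fin.remQuot {m} n j)

kron-conv : ∀ {I : Set} {m n} (g : I → Vec ℚ m) (w : Vec ℚ n) {u} → InConv g u → InConv (λ i → kron (g i) w) (kron u w)
kron-conv g w (L , 0≤L , weight≡1 , combo≡u) = L , 0≤L , weight≡1 , trans (kron-combo g L w) (cong (λ v → kron v w) combo≡u)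

extend : ∀ {k p} {ps : Vec ℕ k} → Fin p → Choice ps → Choice (p ∷ ps)
extend b c zero    = b
extend b c (suc i) = c i

embed : ∀ {p} → Fin (p ∸ 1) → Fin p
embed {suc n} r = inject₁ r

lookup-simplexGen-embed : ∀ {p} (r r′ : Fin (p ∸ 1)) → lookup (simplexGen p (embed r)) r′ ≡ δ r r′
lookup-simplexGen-embed {suc n} r r′ = trans (lookup-simplexGen (inject₁ r) r′) (entry-inject₁ r r′)

basis : ∀ {k} (ps : Vec ℕ k) → Fin (dim ps) → Choice ps
basis (p ∷ ps) s zero    = embed (proj₁ (Fin.remQuot {p ∸ 1} (dim ps) s))
basis (p ∷ ps) s (suc i) = basis ps (proj₂ (Fin.remQuot {p ∸ 1} (dim ps) s)) i

lookup-basis : ∀ {k} (ps : Vec ℕ k) s s′ → lookup (cycloGen ps (basis ps s)) s′ ≡ δ s s′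
lookup-basis []       zero zero = refl
lookup-basis (p ∷ ps) s    s′   = begin
  lookup (cycloGen (p ∷ ps) (basis (p ∷ ps) s)) s′
    ≡⟨ cong (lookup (cycloGen (p ∷ ps) (basis (p ∷ ps) s))) (combine-remQuot {p ∸ 1} (dim ps) s′) ⟨
  lookup (cycloGen (p ∷ ps) (basis (p ∷ ps) s)) (Fin.combine r′ t′)
    ≡⟨ lookup-kron (simplexGen p (embed r)) (cycloGen ps (basis ps t)) r′ t′ ⟩
  lookup (simplexGen p (embed r)) r′ * lookup (cycloGen ps (basis ps t)) t′
    ≡⟨ cong₂ _*_ (lookup-simplexGen-embed {p} r r′) (lookup-basis ps t t′) ⟩
  δ r r′ * δ t t′
    ≡⟨ δ-combine r r′ t t′ ⟨
  δ (Fin.combine r t) (Fin.combine r′ t′)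
    ≡⟨ cong₂ δ (combine-remQuot {p ∸ 1} (dim ps) s) (combine-remQuot {p ∸ 1} (dim ps) s′) ⟩
  δ s s′ ∎
  where
  open ≡-Reasoning
  r r′ : Fin (p ∸ 1)
  r  = proj₁ (Fin.remQuot {p ∸ 1} (dim ps) s)
  r′ = proj₁ (Fin.remQuot {p ∸ 1} (dim ps) s′)
  t t′ : Fin (dim ps)
  t  = proj₂ (Fin.remQuot {p ∸ 1} (dim ps) s)
  t′ = proj₂ (Fin.remQuot {p ∸ 1} (dim ps) s′)

dim-nonZero : ∀ {k} (ps : Vec ℕ k) → (∀ i → 2 ℕ.≤ lookup ps i) → ℕ.NonZero (dim ps)
dim-nonZero []       _    = _
dim-nonZero (p ∷ ps) 2≤ps with 2≤ps zero
... | s≤s (s≤s z≤n) = ℕ.m*n≢0 (p ∸ 1) (dim ps) {{_}} {{dim-nonZero ps (2≤ps ∘ suc)}}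

-- The cyclotomic polytope

module _ {k} (ps : Vec ℕ k) where

  component : MultiIndex ps → Choice ps → ℚ
  component a c = ∏ (λ i → entry (c i) (a i))

  component-trit : ∀ a c → Trit (component a c)
  component-trit a c = ∏-trit (λ i → entry-trit (c i) (a i))

  generator-trit : ∀ c j → Trit (lookup (cycloGen ps c) j)
  generator-trit c j = subst (λ j → Trit (lookup (cycloGen ps c) j)) (flatten-unflatten ps j)
    (subst Trit (sym (lookup-cycloGen ps c (unflatten ps j))) (component-trit (unflatten ps j) c))

  vertex-trit : ∀ x → IsVertex (cycloGen ps) x → ∀ j → Trit (lookup x j)
  vertex-trit x x-vertex j = subst (λ v → Trit (lookup v j)) gc≡x (generator-trit c j)
    where
    c : Choice ps
    c = proj₁ (vertex⇒generator (cycloGen ps) x-vertex)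
    gc≡x : cycloGen ps c ≡ x
    gc≡x = proj₂ (vertex⇒generator (cycloGen ps) x-vertex)

  component-update : ∀ a c i {r′} → r′ ≢ a i → component a c ≢ 0ℚ →
                     component (updateᵈ a i r′) c ≡ component a c * isLast (c i)
  component-update a c i {r′} r′≢ai component≢0 = begin
    ∏ g                      ≡⟨ ∏g≡ ⟩
    g i * R                  ≡⟨ cong (_* R) gi≡ ⟩
    f i * isLast (c i) * R   ≡⟨ swap (f i) (isLast (c i)) R ⟩
    f i * R * isLast (c i)   ≡⟨ cong (_* isLast (c i)) ∏f≡ ⟨
    ∏ f * isLast (c i)       ∎
    where
    open ≡-Reasoning
    f g : Fin k → ℚ
    f j = entry (c j) (a j)
    g j = entry (c j) (updateᵈ a i r′ j)
    split : Σ ℚ (λ R → ∏ f ≡ f i * R × ∏ g ≡ g i * R)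
    split = ∏-split f g i (λ j j≢i → cong (entry (c j)) (sym (updateᵈ-other a i r′ j j≢i)))
    R : ℚ
    R = proj₁ split
    ∏f≡ : ∏ f ≡ f i * R
    ∏f≡ = proj₁ (proj₂ split)
    ∏g≡ : ∏ g ≡ g i * R
    ∏g≡ = proj₂ (proj₂ split)
    gi≡ : g i ≡ f i * isLast (c i)
    gi≡ = trans (cong (entry (c i)) (updateᵈ-same a i r′)) (entry-off (c i) r′≢ai (∏-factor-≢0 f i component≢0))
    swap : ∀ x y z → x * y * z ≡ x * z * y
    swap = solve-∀ ℚ-ring

  module _ {L : List (ℚ × Choice ps)} {x} (0≤L : NonNeg L) (weight≡1 : weight L ≡ 1ℚ)
           (combo≡x : combo (cycloGen ps) L ≡ x) where

    coordinate≡wsum : ∀ a → lookup x (flatten ps a) ≡ wsum L (component a)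
    coordinate≡wsum a = trans (cong (λ v → lookup v (flatten ps a)) (sym combo≡x))
      (trans (lookup-combo (cycloGen ps) L (flatten ps a)) (wsum-cong L (everywhere (λ c → lookup-cycloGen ps c a) L)))

    sign-component : ∀ a → Sign (lookup x (flatten ps a)) → OnSupport (λ c → component a c ≡ lookup x (flatten ps a)) L
    sign-component a sign = onSupport-map (λ {c} gc≡xa → trans (sym (lookup-cycloGen ps c a)) gc≡xa)
      (sign-face (cycloGen ps) 0≤L weight≡1 combo≡x (flatten ps a) (λ c → generator-trit c (flatten ps a)) sign)

    isLast-constant : (∀ j → Trit (lookup x j)) → ∀ a → Sign (lookup x (flatten ps a)) → ∀ i → 3 ℕ.≤ lookup ps i →
                      OnSupport (λ c → isLast (c i) ≡ wsum L (λ c → isLast (c i))) L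
    isLast-constant trit a sign-X i 3≤p = bit-average 0≤L weight≡1 (λ c → isLast-bit (c i)) trit-U
      where
      X U : ℚ
      X = lookup x (flatten ps a)
      U = wsum L (λ c → isLast (c i))
      moved : Σ (Fin (lookup ps i ∸ 1)) (λ r′ → r′ ≢ a i)
      moved = another 3≤p (a i)
      a′ : MultiIndex ps
      a′ = updateᵈ a i (proj₁ moved)
      moved-component : ∀ {c} → component a c ≡ X → component a′ c ≡ X * isLast (c i)
      moved-component {c} comp≡X =
        trans (component-update a c i (proj₂ moved) (λ comp≡0 → sign⇒≢0 sign-X (trans (sym comp≡X) comp≡0)))
              (cong (_* isLast (c i)) comp≡X)
      xa′≡XU : lookup x (flatten ps a′) ≡ X * U
      xa′≡XU = trans (coordinate≡wsum a′)
        (trans (wsum-cong L (onSupport-map (λ {c} → moved-component {c}) (sign-component a sign-X))) (wsum-scale L X _))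
      trit-U : Trit U
      trit-U = subst Trit (trans (cong (X *_) xa′≡XU) (sign-*-involutive sign-X U)) (trit-* (inj₂ sign-X) (trit _))

module _ {k} (ps : Vec ℕ k) (2≤ps : ∀ i → 2 ℕ.≤ lookup ps i)
         (ps-injective : ∀ i j → lookup ps i ≡ lookup ps j → i ≡ j) where

  -- Only one factor can have p = 2; it is fixed by the value of the product once all others are.
  pin : ∀ a {c c′} → component ps a c ≡ component ps a c′ → component ps a c ≢ 0ℚ →
        (∀ i → 3 ℕ.≤ lookup ps i → isLast (c i) ≡ isLast (c′ i)) → ∀ i → c i ≡ c′ i
  pin a {c} {c′} same component≢0 lasts i = pin-at i (3 ℕ.≤? lookup ps i)
    where
    f g : Fin k → ℚ
    f j = entry (c j) (a j)
    g j = entry (c′ j) (a j)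
    pinned : ∀ j → 3 ℕ.≤ lookup ps j → c j ≡ c′ j
    pinned j 3≤p = entry-isLast-injective (c j) (c′ j) (a j)
      (∏-factor-≢0 f j component≢0) (∏-factor-≢0 g j (component≢0 ∘ trans same)) (lasts j 3≤p)
    is-two : ∀ j → ¬ 3 ℕ.≤ lookup ps j → lookup ps j ≡ 2
    is-two j 3≰p = ℕ.≤-antisym (ℕ.≤-pred (ℕ.≰⇒> 3≰p)) (2≤ps j)
    pin-at : ∀ j → Dec (3 ℕ.≤ lookup ps j) → c j ≡ c′ j
    pin-at j (yes 3≤p) = pinned j 3≤p
    pin-at j (no 3≰p)  = entry-injective (c j) (c′ j) (a j) fj≡gj (∏-factor-≢0 f j component≢0)
      where
      others : ∀ l → l ≢ j → c l ≡ c′ l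
      others l l≢j with 3 ℕ.≤? lookup ps l
      ... | yes 3≤p′ = pinned l 3≤p′
      ... | no 3≰p′  = contradiction (ps-injective l j (trans (is-two l 3≰p′) (sym (is-two j 3≰p)))) l≢j
      split : Σ ℚ (λ R → ∏ f ≡ f j * R × ∏ g ≡ g j * R)
      split = ∏-split f g j (λ l l≢j → cong (λ b → entry b (a l)) (others l l≢j))
      R≢0 : proj₁ split ≢ 0ℚ
      R≢0 R≡0 = component≢0 (trans (proj₁ (proj₂ split)) (trans (cong (f j *_) R≡0) (*-zeroʳ (f j))))
      fj≡gj : f j ≡ g j
      fj≡gj = *-cancelʳ-≢0 R≢0 (trans (sym (proj₁ (proj₂ split))) (trans same (proj₂ (proj₂ split))))

  trit-rigid : ∀ {x} → (∀ j → Trit (lookup x j)) → ∀ j → lookup x j ≢ 0ℚ → Rigid (cycloGen ps) x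
  trit-rigid {x} trit j xj≢0 L 0≤L weight≡1 combo≡x =
    onSupport-map (λ c≗c₀ → trans (cycloGen-cong ps c≗c₀) gc₀≡x) all-c₀
    where
    a : MultiIndex ps
    a = unflatten ps j
    X : ℚ
    X = lookup x (flatten ps a)
    sign-X : Sign X
    sign-X = trit∧≢0⇒sign (trit _) (subst (λ j → lookup x j ≢ 0ℚ) (sym (flatten-unflatten ps j)) xj≢0)
    U : Fin k → ℚ
    U i = wsum L (λ c → isLast (c i))
    on-a : OnSupport (λ c → component ps a c ≡ X) L
    on-a = sign-component ps 0≤L weight≡1 combo≡x a sign-X
    on-lasts : OnSupport (λ c → ∀ i → 3 ℕ.≤ lookup ps i → isLast (c i) ≡ U i) L
    on-lasts = onSupport-∀ L (λ i → onSupport-∀ L (isLast-constant ps 0≤L weight≡1 combo≡x trit a sign-X i))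
    witness : Σ (Choice ps) (λ c → ∀ {P : Choice ps → Set} → OnSupport P L → P c)
    witness = support-witness L (λ weight≡0 → 1≢0 (trans (sym weight≡1) weight≡0))
    c₀ : Choice ps
    c₀ = proj₁ witness
    all-c₀ : OnSupport (λ c → ∀ i → c i ≡ c₀ i) L
    all-c₀ = onSupport-map (λ {c} (comp≡X , lasts≡U) →
               pin a (trans comp≡X (sym (proj₂ witness on-a))) (λ comp≡0 → sign⇒≢0 sign-X (trans (sym comp≡X) comp≡0))
                   (λ i 3≤p → trans (lasts≡U i 3≤p) (sym (proj₂ witness on-lasts i 3≤p))))
               (onSupport-× on-a on-lasts)
    gc₀≡x : cycloGen ps c₀ ≡ x
    gc₀≡x = trans (sym (combo-onSupport (cycloGen ps) (onSupport-map (λ {c} → cycloGen-cong ps {c} {c₀}) all-c₀) weight≡1)) combo≡x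

  generator-vertex : ∀ c → IsVertex (cycloGen ps) (cycloGen ps c)
  generator-vertex c =
    rigid⇒vertex (cycloGen ps) (generator∈conv (cycloGen ps) c) (trit-rigid (generator-trit ps c) (flatten ps a) gc≢0)
    where
    a : MultiIndex ps
    a i = proj₁ (entry-sign (2≤ps i) (c i))
    gc≢0 : lookup (cycloGen ps c) (flatten ps a) ≢ 0ℚ
    gc≢0 = subst (_≢ 0ℚ) (sym (lookup-cycloGen ps c a)) (sign⇒≢0 (∏-sign (λ i → proj₂ (entry-sign (2≤ps i) (c i)))))

  lattice-point : ∀ x → IsLatticePoint x → InConv (cycloGen ps) x → IsVertex (cycloGen ps) x ⊎ x ≡ replicate _ 0ℚ
  lattice-point x integral x∈conv with zero⊎nonzero x
  ... | inj₁ x≡0         = inj₂ x≡0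
  ... | inj₂ (j , xj≢0) = inj₁ (rigid⇒vertex (cycloGen ps) x∈conv (trit-rigid trit j xj≢0))
    where
    trit : ∀ j → Trit (lookup x j)
    trit j = integer-trit (integral j) (proj₁ bounds) (proj₂ bounds)
      where
      bounds : - 1ℚ ≤ lookup x j × lookup x j ≤ 1ℚ
      bounds = conv-trit-bounds (cycloGen ps) x∈conv j (λ c → generator-trit ps c j)

  vertex⇔tensor : ∀ x → IsVertex (cycloGen ps) x ⇔
    Σ ((i : Fin k) → Vec ℚ (lookup ps i ∸ 1)) (λ vs → (∀ i → IsVertex (simplexGen (lookup ps i)) (vs i)) × x ≡ tensor ps vs)
  vertex⇔tensor x = mk⇔ to from
    where
    to : IsVertex (cycloGen ps) x →
         Σ ((i : Fin k) → Vec ℚ (lookup ps i ∸ 1)) (λ vs → (∀ i → IsVertex (simplexGen (lookup ps i)) (vs i)) × x ≡ tensor ps vs)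
    to x-vertex with vertex⇒generator (cycloGen ps) x-vertex
    ... | c , gc≡x = (λ i → simplexGen (lookup ps i) (c i)) , (λ i → simplex-vertex (2≤ps i) (c i)) , sym gc≡x
    from : Σ ((i : Fin k) → Vec ℚ (lookup ps i ∸ 1)) (λ vs → (∀ i → IsVertex (simplexGen (lookup ps i)) (vs i)) × x ≡ tensor ps vs) →
           IsVertex (cycloGen ps) x
    from (vs , vs-vertex , x≡vs) = subst (IsVertex (cycloGen ps)) (sym (trans x≡vs (tensor-cong ps vs≡))) (generator-vertex c)
      where
      c : Choice ps
      c i = proj₁ (vertex⇒generator (simplexGen (lookup ps i)) (vs-vertex i))
      vs≡ : ∀ i → vs i ≡ simplexGen (lookup ps i) (c i)
      vs≡ i = sym (proj₂ (vertex⇒generator (simplexGen (lookup ps i)) (vs-vertex i)))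

column : ∀ m {d} → ℚ → Vec ℚ (m ℕ.* d) → Fin d → Vec ℚ m
column m c y t = Vec.tabulate (λ r → c * lookup y (Fin.combine r t))

average-of-columns : ∀ {k m} (ps : Vec ℕ k) .{{_ : ℕ.NonZero (dim ps)}} (y : Vec ℚ (m ℕ.* dim ps)) j →
  lookup y j ≡ sum (λ t → 1/ℕ (dim ps) * lookup (kron (column m (dim ps · 1ℚ) y t) (cycloGen ps (basis ps t))) j)
average-of-columns {m = m} ps y j = begin
  lookup y j                                      ≡⟨ cong (lookup y) (combine-remQuot {m} d j) ⟨
  lookup y (Fin.combine r s)                      ≡⟨ sum-δ (λ t → lookup y (Fin.combine r t)) s ⟨
  sum (λ t → lookup y (Fin.combine r t) * δ t s) ≡⟨ sum-cong-≗ (λ t → sym (averaged t)) ⟩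
  sum (λ t → 1/ℕ d * lookup (z t) (Fin.combine r s))
    ≡⟨ cong (λ j → sum (λ t → 1/ℕ d * lookup (z t) j)) (combine-remQuot {m} d j) ⟩
  sum (λ t → 1/ℕ d * lookup (z t) j)             ∎
  where
  open ≡-Reasoning
  d : ℕ
  d = dim ps
  z : Fin d → Vec ℚ (m ℕ.* d)
  z t = kron (column m (d · 1ℚ) y t) (cycloGen ps (basis ps t))
  r : Fin m
  r = proj₁ (Fin.remQuot {m} d j)
  s : Fin d
  s = proj₂ (Fin.remQuot {m} d j)
  averaged : ∀ t → 1/ℕ d * lookup (z t) (Fin.combine r s) ≡ lookup y (Fin.combine r t) * δ t s
  averaged t = begin
    1/ℕ d * lookup (z t) (Fin.combine r s)
      ≡⟨ cong (1/ℕ d *_) (lookup-kron (column m (d · 1ℚ) y t) (cycloGen ps (basis ps t)) r s) ⟩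
    1/ℕ d * (lookup (column m (d · 1ℚ) y t) r * lookup (cycloGen ps (basis ps t)) s)
      ≡⟨ cong₂ (λ a b → 1/ℕ d * (a * b)) (lookup∘tabulate _ r) (lookup-basis ps t s) ⟩
    1/ℕ d * ((d · 1ℚ) * lookup y (Fin.combine r t) * δ t s)
      ≡⟨ regroup (1/ℕ d) (d · 1ℚ) (lookup y (Fin.combine r t)) (δ t s) ⟩
    (d · 1ℚ) * (lookup y (Fin.combine r t) * δ t s * 1/ℕ d)
      ≡⟨ 1/ℕ-cancel d (lookup y (Fin.combine r t) * δ t s) ⟩
    lookup y (Fin.combine r t) * δ t s ∎
    where
    regroup : ∀ a b x y → a * (b * x * y) ≡ b * (x * y * a)
    regroup = solve-∀ ℚ-ring

interior : ∀ {k p} (ps : Vec ℕ k) → 2 ℕ.≤ p → (∀ i → 2 ℕ.≤ lookup ps i) → IsInterior (cycloGen (p ∷ ps)) (replicate _ 0ℚ)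
interior {p = p} ps 2≤p 2≤ps = ε , 0<ε , box
  where
  d : ℕ
  d = dim ps
  instance
    d-nonZero : ℕ.NonZero d
    d-nonZero = dim-nonZero ps 2≤ps
  N : ℚ
  N = d · 1ℚ
  η : ℚ
  η = proj₁ (simplex-box 2≤p)
  ε : ℚ
  ε = η * 1/ℕ d
  0<ε : 0ℚ < ε
  0<ε = subst (_< ε) (*-zeroˡ (1/ℕ d)) (*-monoˡ-<-pos (1/ℕ d) {{ℚ.positive (1/ℕ-positive d)}} (proj₁ (proj₂ (simplex-box 2≤p))))
  box : ∀ y → (∀ j → ∣ lookup y j - lookup (replicate _ 0ℚ) j ∣ ≤ ε) → InConv (cycloGen (p ∷ ps)) y
  box y y-0≤ε =
    conv-combination (cycloGen (p ∷ ps)) (λ _ → 1/ℕ d) (λ t → kron (column (p ∸ 1) N y t) (cycloGen ps (basis ps t)))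
                     (λ _ → <⇒≤ (1/ℕ-positive d)) weights≡1 column∈conv (average-of-columns {m = p ∸ 1} ps y)
    where
    ∣y∣≤ε : ∀ j → ∣ lookup y j ∣ ≤ ε
    ∣y∣≤ε j = subst (λ q → ∣ q ∣ ≤ ε)
                (trans (cong (λ q → lookup y j - q) (lookup-replicate j 0ℚ)) (+-identityʳ (lookup y j))) (y-0≤ε j)
    column-small : ∀ t r → ∣ lookup (column (p ∸ 1) N y t) r ∣ ≤ η
    column-small t r = begin
      ∣ lookup (column (p ∸ 1) N y t) r ∣
        ≡⟨ cong ∣_∣ (lookup∘tabulate _ r) ⟩
      ∣ N * lookup y (Fin.combine r t) ∣
        ≡⟨ trans (∣p*q∣≡∣p∣*∣q∣ N _) (cong (_* ∣ lookup y (Fin.combine r t) ∣) (0≤p⇒∣p∣≡p (·-nonNeg d))) ⟩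
      N * ∣ lookup y (Fin.combine r t) ∣
        ≤⟨ *-monoˡ-≤-nonNeg N {{ℚ.nonNegative (·-nonNeg d)}} (∣y∣≤ε (Fin.combine r t)) ⟩
      N * (η * 1/ℕ d)
        ≡⟨ 1/ℕ-cancel d η ⟩
      η ∎
      where open ≤-Reasoning
    column∈conv : ∀ t → InConv (cycloGen (p ∷ ps)) (kron (column (p ∸ 1) N y t) (cycloGen ps (basis ps t)))
    column∈conv t = conv-reindex (cycloGen (p ∷ ps)) (λ b → extend b (basis ps t))
      (kron-conv (simplexGen p) (cycloGen ps (basis ps t)) (proj₂ (proj₂ (simplex-box 2≤p)) (column (p ∸ 1) N y t) (column-small t)))
    weights≡1 : sum {d} (λ _ → 1/ℕ d) ≡ 1ℚ
    weights≡1 = trans (sum-replicate d {1/ℕ d}) (trans (n·x≡[n·1]*x d (1/ℕ d)) (1/ℕ-inverse d))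

lemma2p6 : (n : ℕ) (ps : Vec ℕ (suc n)) →
    (∀ i → Prime (lookup ps i)) →
    (∀ i j → lookup ps i ≡ lookup ps j → i ≡ j) →
    (∀ x → IsVertex (cycloGen ps) x →
       ∀ j → lookup x j ≡ 0ℚ ⊎ lookup x j ≡ 1ℚ ⊎ lookup x j ≡ - 1ℚ)
    × (∀ x → IsVertex (cycloGen ps) x ⇔
       Σ ((i : Fin (suc n)) → Vec ℚ (lookup ps i ∸ 1)) (λ vs →
         (∀ i → IsVertex (simplexGen (lookup ps i)) (vs i)) × x ≡ tensor ps vs))
    × (∀ x → IsLatticePoint x → InConv (cycloGen ps) x →
       IsVertex (cycloGen ps) x ⊎ x ≡ replicate _ 0ℚ)
    × IsInterior (cycloGen ps) (replicate _ 0ℚ)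
lemma2p6 n (p ∷ ps) prime distinct =
  vertex-trit (p ∷ ps) ,
  vertex⇔tensor (p ∷ ps) 2≤ distinct ,
  lattice-point (p ∷ ps) 2≤ distinct ,
  interior ps (2≤ zero) (2≤ ∘ suc)
  where
  2≤ : ∀ i → 2 ℕ.≤ lookup (p ∷ ps) i
  2≤ i = ℕ.nonTrivial⇒n>1 _ {{prime⇒nonTrivial (prime i)}}
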